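{- Consider an instance of stochastic set cover with perfect coverage, as defined in the context: a finite ground set $\mathcal{B}$, a finite set of items $\mathcal{A}$ with costs $C(F)\ge 0$, mutually independent random states $V(F)\sim p_F$ with marginals $q_F(e)=\Pr[e\in V(F)]$, and $\Pr\left[\bigcup_{F\in\mathcal{A}}V(F)=\mathcal{B}\right]=1$. Let $G$ be the (random) set of items evaluated by the algorithm \texttt{Greedy}, and let $O$ be the (random) set of items evaluated by an optimal algorithm, i.e. a feasible adaptive oblivious algorithm minimizing $\mathbf{E}\left[\sum_{F\in O}C(F)\right]$. Then $$\mathbf{E}\Big[\sum_{F\in G}C(F)\Big]\;\le\; H(|\mathcal{B}|)\,\mathbf{E}\Big[\sum_{F\in O}C(F)\Big],$$ where $H(n)=\sum_{k=1}^n 1/k$ is the $n$-th harmonic number. That is, \texttt{Greedy} has approximation ratio $H(|\mathcal{B}|)$.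
   Context: Stochastic set cover: we are given a finite ground set $\mathcal{B}$ and a finite set of items $\mathcal{A}$. Each item $F\in\mathcal{A}$ has a cost $C(F)\ge 0$ and a probability distribution $p_F$ on $2^{\mathcal{B}}$; the state of $F$ is a random subset $V(F)\sim p_F$, and the states of distinct items are mutually independent. Let $q_F(e)=\Pr[e\in V(F)]$ for $(F,e)\in\mathcal{A}\times\mathcal{B}$. Evaluating an item reveals its state (re-evaluating, or evaluation by different algorithms, yields the same state). An (adaptive) algorithm evaluates items one at a time, where the choice of the next item (or the decision to stop) may depend on the states of previously evaluated items. The algorithm is oblivious: conditioning on the event that an item was evaluated does not change that item's state distribution (equivalently, the decision to evaluate $F$ depends only on the states of other items). An algorithm is feasible if the set $\mathcal{S}$ of items it evaluates satisfies $\Pr\left[\bigcup_{F\in\mathcal{S}}V(F)=\bigcup_{F\in\mathcal{A}}V(F)\right]=1$; its cost is $\mathbf{E}[\sum_{F\in\mathcal{S}}C(F)]$. In the perfect-coverage variant one additionally assumes $\Pr\left[\bigcup_{F\in\mathcal{A}}V(F)=\mathcal{B}\right]=1$. Algorithm \texttt{Greedy}: set $\mathcal{A}_1=\mathcal{A}$, $\mathcal{B}_1=\mathcal{B}$. At step $i$, with residual system $(\mathcal{A}_i,\mathcal{B}_i)$ ($\mathcal{A}_i$ the items not yet evaluated, $\mathcal{B}_i$ the elements not in the state of any evaluated item): if $\mathcal{B}_i=\emptyset$, stop. Otherwise evaluate an item $F_i\in\mathcal{A}_i$ with $\sum_{e\in\mathcal{B}_i}q_F(e)>0$ minimizing $C(F)/\sum_{e\in\mathcal{B}_i}q_F(e)$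 (ties broken arbitrarily), and set $\mathcal{A}_{i+1}=\mathcal{A}_i\setminus\{F_i\}$, $\mathcal{B}_{i+1}=\mathcal{B}_i\setminus V(F_i)$.
   Formalization: The costs $C(F)$ and all probabilities assigned by the state distributions $p_F$ are rational numbers. -}

module Defs where

open import Data.Nat using (ℕ; zero; suc)
open import Data.Fin using (Fin)
open import Data.Bool using (Bool; true; false; if_then_else_)
import Data.Bool as Bool
open import Data.List using (List; []; _∷_; concatMap; map)
open import Data.Vec using (Vec; []; _∷_; lookup; tabulate)
import Data.Vec.Properties as VecP
open import Data.Fin.Subset using (Subset; ⊥; ⊤; ⁅_⁆; _∪_; _─_; _∈_; _∉_)
open import Data.Integer using (+_)
open import Data.Rational using (ℚ; 0ℚ; 1ℚ; _+_; _*_; _÷_; _/_; _<_; _≤_; >-nonZero)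
open import Relation.Nullary.Decidable using (⌊_⌋)
open import Relation.Binary.PropositionalEquality using (_≡_; _≢_)

sumℚ : List ℚ → ℚ
sumℚ []       = 0ℚ
sumℚ (x ∷ xs) = x + sumℚ xs

sumFin : (k : ℕ) → (Fin k → ℚ) → ℚ
sumFin zero    f = 0ℚ
sumFin (suc k) f = f Fin.zero + sumFin k (λ i → f (Fin.suc i))
  where import Data.Fin as Fin

prodFin : (k : ℕ) → (Fin k → ℚ) → ℚ
prodFin zero    f = 1ℚ
prodFin (suc k) f = f Fin.zero * prodFin k (λ i → f (Fin.suc i))
  where import Data.Fin as Fin

𝟙 : Bool → ℚ
𝟙 true  = 1ℚ
𝟙 false = 0ℚ

_∈ᵇ_ : {k : ℕ} → Fin k → Subset k → Bool
x ∈ᵇ S = lookup S x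

allSubsets : (m : ℕ) → List (Subset m)
allSubsets zero    = [] ∷ []
allSubsets (suc m) = concatMap (λ s → (true ∷ s) ∷ (false ∷ s) ∷ []) (allSubsets m)

-- a realization assigns to every item F : Fin n its state V(F) ⊆ Fin m
Realization : ℕ → ℕ → Set
Realization n m = Vec (Subset m) n

allRealizations : (n m : ℕ) → List (Realization n m)
allRealizations zero    m = [] ∷ []
allRealizations (suc n) m =
  concatMap (λ ω → map (λ S → S ∷ ω) (allSubsets m)) (allRealizations n m)

-- Stochastic set cover instance:
--   ground set B = Fin m, items A = Fin n,
--   C : Fin n → ℚ costs, p F : Subset m → ℚ the distribution p_F of V(F).
-- States of distinct items are independent: the joint law is the product.

module _ {n m : ℕ} (p : Fin n → Subset m → ℚ) where

  Pr : Realization n m → ℚ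
  Pr ω = prodFin n (λ F → p F (lookup ω F))

  𝔼 : (Realization n m → ℚ) → ℚ
  𝔼 X = sumℚ (map (λ ω → Pr ω * X ω) (allRealizations n m))

  Prob : (Realization n m → Bool) → ℚ
  Prob E = 𝔼 (λ ω → 𝟙 (E ω))

  q : Fin n → Fin m → ℚ
  q F e = sumℚ (map (λ S → p F S * 𝟙 (e ∈ᵇ S)) (allSubsets m))

unionAll : {n m : ℕ} → Realization n m → Subset m
unionAll []      = ⊥
unionAll (S ∷ ω) = S ∪ unionAll ω

_==ˢ_ : {m : ℕ} → Subset m → Subset m → Bool
A ==ˢ B = ⌊ VecP.≡-dec Bool._≟_ A B ⌋

record IsInstance {n m : ℕ} (C : Fin n → ℚ) (p : Fin n → Subset m → ℚ) : Set where
  field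
    cost-nonneg : ∀ F → 0ℚ ≤ C F
    prob-nonneg : ∀ F S → 0ℚ ≤ p F S
    prob-sum1   : ∀ F → sumℚ (map (p F) (allSubsets m)) ≡ 1ℚ

PerfectCoverage : {n m : ℕ} → (Fin n → Subset m → ℚ) → Set
PerfectCoverage p = Prob p (λ ω → unionAll ω ==ˢ ⊤) ≡ 1ℚ

-- Adaptive algorithms as decision trees: either stop, or evaluate an
-- item F and continue depending on the revealed state V(F).

data Tree (n m : ℕ) : Set where
  stop : Tree n m
  eval : Fin n → (Subset m → Tree n m) → Tree n m

evaluatedFrom : {n m : ℕ} → Tree n m → Realization n m → Subset n → Subset n
evaluatedFrom stop       ω acc = acc
evaluatedFrom (eval F k) ω acc = evaluatedFrom (k (lookup ω F)) ω (acc ∪ ⁅ F ⁆)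

evaluated : {n m : ℕ} → Tree n m → Realization n m → Subset n
evaluated T ω = evaluatedFrom T ω ⊥

coveredFrom : {n m : ℕ} → Tree n m → Realization n m → Subset m → Subset m
coveredFrom stop       ω acc = acc
coveredFrom (eval F k) ω acc = coveredFrom (k (lookup ω F)) ω (acc ∪ lookup ω F)

covered : {n m : ℕ} → Tree n m → Realization n m → Subset m
covered T ω = coveredFrom T ω ⊥

costOn : {n m : ℕ} → (Fin n → ℚ) → Tree n m → Realization n m → ℚ
costOn {n} C T ω = sumFin n (λ F → 𝟙 (F ∈ᵇ evaluated T ω) * C F)

expCost : {n m : ℕ} → (Fin n → ℚ) → (Fin n → Subset m → ℚ) → Tree n m → ℚ
expCost C p T = 𝔼 p (costOn C T)

Feasible : {n m : ℕ} → (Fin n → Subset m → ℚ) → Tree n m → Set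
Feasible p T = Prob p (λ ω → covered T ω ==ˢ unionAll ω) ≡ 1ℚ

mass : {n m : ℕ} → (Fin n → Subset m → ℚ) → Fin n → Subset m → ℚ
mass {m = m} p F U = sumFin m (λ e → 𝟙 (e ∈ᵇ U) * q p F e)

ratio : (c s : ℚ) → 0ℚ < s → ℚ
ratio c s pos = _÷_ c s {{>-nonZero pos}}

-- IsGreedyFrom C p E U T : T is a run of Greedy (with some tie-breaking)
-- from the residual system whose evaluated items are E (so A_i = complement
-- of E) and whose uncovered elements are U (= B_i).  Behaviour on branches
-- of probability zero is unconstrained.
data IsGreedyFrom {n m : ℕ} (C : Fin n → ℚ) (p : Fin n → Subset m → ℚ)
     : Subset n → Subset m → Tree n m → Set where
  gstop : ∀ {E U} → U ≡ ⊥ → IsGreedyFrom C p E U stop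
  geval : ∀ {E U F k} →
    U ≢ ⊥ →
    F ∉ E →
    (pos : 0ℚ < mass p F U) →
    (∀ F′ → F′ ∉ E → (pos′ : 0ℚ < mass p F′ U) →
       ratio (C F) (mass p F U) pos ≤ ratio (C F′) (mass p F′ U) pos′) →
    (∀ S → 0ℚ < p F S → IsGreedyFrom C p (E ∪ ⁅ F ⁆) (U ─ S) (k S)) →
    IsGreedyFrom C p E U (eval F k)

IsGreedy : {n m : ℕ} → (Fin n → ℚ) → (Fin n → Subset m → ℚ) → Tree n m → Set
IsGreedy C p T = IsGreedyFrom C p ⊥ ⊤ T

harmonic : ℕ → ℚ
harmonic zero    = 0ℚ
harmonic (suc k) = harmonic k + (+ 1) / suc k

-- Greedy is compared with an arbitrary feasible tree O by induction along its run.  If E is the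
-- set of items evaluated so far and U the set of elements still uncovered, then under any product
-- law that keeps the original laws outside E and gives the items of E states disjoint from U,
--   E[cost of the rest of Greedy] ≤ H(|U|) · E[cost O spends on items outside E].
-- When Greedy picks F with ratio ρ = C(F) / Σ_{e∈U} q_F(e), every item outside E costs at least
-- ρ times its expected number of elements of U.  As O is oblivious, "O evaluates F′" is
-- independent of V(F′), so O spends at least ρ times the expected number of elements of U it
-- covers with items outside E ∪ {F}; given V(F) = S this is at least ρ (|U| − π |U ∩ S|), where
-- π = Pr[O evaluates F].  Together with the induction hypothesis for each outcome S and the
-- estimate s ≤ (H(s+a) − H(a)) (s+a), this closes the induction; at the root E = ∅ and U = B.

module Submission where

open import Defs
open import Data.Nat using (ℕ; zero; suc)
open import Data.Fin using (Fin)
open import Data.Fin.Subset using (Subset)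
open import Data.Rational using (ℚ; _≤_; _*_)

import Data.Rational.Properties as ℚP
open import Data.Bool using (Bool; true; false; T; _∧_; _∨_; not)
import Data.Bool as Bool
import Data.Bool.Properties as BoolP
open import Data.Empty using (⊥-elim)
open import Data.Fin using (zero; suc; _≟_)
import Data.Fin.Properties as FinP
open import Data.Fin.Subset using (_∪_; _∩_; _─_; ⁅_⁆; ∣_∣; _∉_) renaming (⊥ to ∅; ⊤ to full)
import Data.Fin.Subset.Properties as SubsetP
open import Data.Integer using (+_)
import Data.Integer as ℤ
import Data.Integer.Properties as ℤP
open import Data.List using (List; []; _∷_; map; _++_; concatMap)
open import Data.List.Membership.Propositional using (_∈_)
open import Data.List.Membership.Propositional.Properties using (∈-concatMap⁺)
open import Data.List.Relation.Unary.Any as Any using (here; there)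
import Data.Nat as ℕ
import Data.Nat.Properties as ℕP
open import Data.Product using (_×_; _,_; ∃)
open import Data.Rational
  using (0ℚ; 1ℚ; _+_; _-_; -_; _<_; _/_; 1/_; toℚᵘ; nonNegative; positive; >-nonZero)
open import Data.Rational.Solver using (module +-*-Solver)
open import Data.Rational.Unnormalised using (mkℚᵘ; 1ℚᵘ; *≡*) renaming (_≃_ to _≃ᵘ_)
import Data.Rational.Unnormalised.Properties as ℚᵘP
open import Data.Sum using (_⊎_; inj₁; inj₂)
open import Data.Vec using ([]; _∷_; lookup; _[_]≔_)
import Data.Vec.Properties as VecP
open import Data.Vec.Functional using (updateAt)
import Data.Vec.Functional.Properties as VecFP
open import Function using (_∘_)
open import Relation.Binary.Definitions using (tri<; tri≈; tri>)
open import Relation.Binary.PropositionalEquality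
open import Relation.Nullary using (Dec; yes; no; does; contradiction)
open import Relation.Nullary.Decidable using (dec-true; dec-false; toWitness)

open import Algebra.Bundles using (Ring; CommutativeMonoid)
open import Algebra.Properties.CommutativeSemigroup
  (CommutativeMonoid.commutativeSemigroup ℚP.+-0-commutativeMonoid) using (interchange)
open import Algebra.Properties.Monoid.Mult ℚP.+-0-monoid using () renaming (_×_ to _·_)
open import Algebra.Properties.Semiring.Sum (Ring.semiring ℚP.+-*-ring)
  using (sum; sum-replicate-zero; ∑-distrib-+; ∑-comm; *-distribˡ-sum)
open +-*-Solver using (solve; _:+_; _:*_; _:-_; :-_; _:=_; con)

0≤1 : 0ℚ ≤ 1ℚ
0≤1 = ℚP.<⇒≤ (ℚP.positive⁻¹ 1ℚ)

+-nonNeg : ∀ {a b} → 0ℚ ≤ a → 0ℚ ≤ b → 0ℚ ≤ a + b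
+-nonNeg 0≤a 0≤b = ℚP.+-mono-≤ 0≤a 0≤b

*-nonNeg : ∀ {a b} → 0ℚ ≤ a → 0ℚ ≤ b → 0ℚ ≤ a * b
*-nonNeg {a} {b} 0≤a 0≤b = ℚP.nonNegative⁻¹ (a * b)
  {{ℚP.nonNeg*nonNeg⇒nonNeg a {{nonNegative 0≤a}} b {{nonNegative 0≤b}}}}

scale-≤ : ∀ {r a b} → 0ℚ ≤ r → a ≤ b → r * a ≤ r * b
scale-≤ {r} 0≤r = ℚP.*-monoˡ-≤-nonNeg r {{nonNegative 0≤r}}

p≤q⇒0≤q-p : ∀ {a b} → a ≤ b → 0ℚ ≤ b - a
p≤q⇒0≤q-p {a} {b} a≤b = subst (_≤ b - a) (ℚP.+-inverseʳ a) (ℚP.+-monoˡ-≤ (- a) a≤b)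

≤-by-slack : ∀ {x y} z → 0ℚ ≤ z → x + z ≡ y → x ≤ y
≤-by-slack {x} {y} z 0≤z x+z≡y =
  subst₂ _≤_ (ℚP.+-identityʳ x) x+z≡y (ℚP.+-monoʳ-≤ x 0≤z)

positive-or-zero : ∀ {a} → 0ℚ ≤ a → 0ℚ < a ⊎ a ≡ 0ℚ
positive-or-zero {a} 0≤a with ℚP.<-cmp 0ℚ a
... | tri< 0<a _ _ = inj₁ 0<a
... | tri≈ _ 0≡a _ = inj₂ (sym 0≡a)
... | tri> _ _ a<0 = ⊥-elim (ℚP.<-irrefl refl (ℚP.<-≤-trans a<0 0≤a))

scale-≤-if-pos : ∀ {a x y} → 0ℚ ≤ a → (0ℚ < a → x ≤ y) → a * x ≤ a * y
scale-≤-if-pos {a} {x} {y} 0≤a x≤y with positive-or-zero 0≤a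
... | inj₁ 0<a = scale-≤ 0≤a (x≤y 0<a)
... | inj₂ a≡0 = ℚP.≤-reflexive (trans (cong (_* x) a≡0)
                   (trans (ℚP.*-zeroˡ x) (sym (trans (cong (_* y) a≡0) (ℚP.*-zeroˡ y)))))

x≤y+z⇒x-z≤y : ∀ {x y z} → x ≤ y + z → x - z ≤ y
x≤y+z⇒x-z≤y {x} {y} {z} x≤y+z = subst (x - z ≤_) (cancel y z) (ℚP.+-monoˡ-≤ (- z) x≤y+z)
  where
  cancel : ∀ y z → y + z - z ≡ y
  cancel = solve 2 (λ y z → y :+ z :- z := y) refl

𝟙-nonNeg : ∀ b → 0ℚ ≤ 𝟙 b
𝟙-nonNeg true  = 0≤1
𝟙-nonNeg false = ℚP.≤-refl

-- Harmonic numbers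

fromℕ : ℕ → ℚ
fromℕ n = n · 1ℚ

fromℕ-nonNeg : ∀ n → 0ℚ ≤ fromℕ n
fromℕ-nonNeg zero    = ℚP.≤-refl
fromℕ-nonNeg (suc n) = +-nonNeg 0≤1 (fromℕ-nonNeg n)

fromℕ-≃ : ∀ n → toℚᵘ (fromℕ n) ≃ᵘ mkℚᵘ (+ n) 0
fromℕ-≃ zero    = *≡* refl
fromℕ-≃ (suc n) = ℚᵘP.≃-trans (ℚP.toℚᵘ-homo-+ 1ℚ (fromℕ n))
  (ℚᵘP.≃-trans (ℚᵘP.+-congʳ 1ℚᵘ (fromℕ-≃ n)) (*≡* eq))
  where
  eq : (+ 1 ℤ.* + 1 ℤ.+ + n ℤ.* + 1) ℤ.* + 1 ≡ + suc n ℤ.* + (1 ℕ.* 1)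
  eq = trans (ℤP.*-identityʳ _) (trans (cong (ℤ._+_ (+ 1)) (ℤP.*-identityʳ (+ n))) (sym (ℤP.*-identityʳ _)))

1/suc*suc : ∀ j → (+ 1 / suc j) * fromℕ (suc j) ≡ 1ℚ
1/suc*suc j = ℚP.toℚᵘ-injective
  (ℚᵘP.≃-trans (ℚP.toℚᵘ-homo-* (+ 1 / suc j) (fromℕ (suc j)))
  (ℚᵘP.≃-trans (ℚᵘP.*-cong (ℚP.toℚᵘ-fromℚᵘ (mkℚᵘ (+ 1) j)) (fromℕ-≃ (suc j))) (*≡* eq)))
  where
  eq : (+ 1 ℤ.* + suc j) ℤ.* + 1 ≡ + 1 ℤ.* + (suc j ℕ.* 1)
  eq = trans (ℤP.*-identityʳ _) (cong (ℤ._*_ (+ 1)) (cong +_ (sym (ℕP.*-identityʳ (suc j)))))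

1/suc-nonNeg : ∀ j → 0ℚ ≤ + 1 / suc j
1/suc-nonNeg j = ℚP.<⇒≤ (ℚP.positive⁻¹ _ {{ℚP.normalize-pos 1 (suc j)}})

harmonic-mono : ∀ s a → harmonic a ≤ harmonic (s ℕ.+ a)
harmonic-mono zero    a = ℚP.≤-refl
harmonic-mono (suc s) a = ℚP.≤-trans (harmonic-mono s a)
  (≤-by-slack (+ 1 / suc (s ℕ.+ a)) (1/suc-nonNeg (s ℕ.+ a)) refl)

harmonic-nonNeg : ∀ k → 0ℚ ≤ harmonic k
harmonic-nonNeg k = subst (λ j → 0ℚ ≤ harmonic j) (ℕP.+-identityʳ k) (harmonic-mono k 0)

-- Each of the s terms 1/(a+1), …, 1/(a+s) is at least 1/(a+s).
harmonic-gap : ∀ s a → fromℕ s ≤ (harmonic (s ℕ.+ a) - harmonic a) * fromℕ (s ℕ.+ a)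
harmonic-gap zero    a = ℚP.≤-reflexive (sym (trans
  (cong (_* fromℕ a) (ℚP.+-inverseʳ (harmonic a))) (ℚP.*-zeroˡ (fromℕ a))))
harmonic-gap (suc s) a =
  ≤-by-slack ((D * t - fromℕ s) + D)
    (+-nonNeg (p≤q⇒0≤q-p (harmonic-gap s a)) (p≤q⇒0≤q-p (harmonic-mono s a)))
    (begin
      1ℚ + fromℕ s + ((D * t - fromℕ s) + D)  ≡⟨ regroup (fromℕ s) D t ⟩
      D * (1ℚ + t) + 1ℚ                       ≡⟨ cong (_+_ (D * (1ℚ + t))) (sym (1/suc*suc j)) ⟩
      D * (1ℚ + t) + x * (1ℚ + t)             ≡⟨ distrib (harmonic j) x (harmonic a) t ⟩
      (harmonic j + x - harmonic a) * (1ℚ + t) ∎)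
  where
  open ≡-Reasoning
  j = s ℕ.+ a
  D = harmonic j - harmonic a
  t = fromℕ j
  x = + 1 / suc j
  regroup : ∀ S D t → 1ℚ + S + ((D * t - S) + D) ≡ D * (1ℚ + t) + 1ℚ
  regroup = solve 3 (λ S D t → con 1ℚ :+ S :+ ((D :* t :- S) :+ D) := D :* (con 1ℚ :+ t) :+ con 1ℚ) refl
  distrib : ∀ h x h′ t → (h - h′) * (1ℚ + t) + x * (1ℚ + t) ≡ (h + x - h′) * (1ℚ + t)
  distrib = solve 4 (λ h x h′ t →
    (h :- h′) :* (con 1ℚ :+ t) :+ x :* (con 1ℚ :+ t) := (h :+ x :- h′) :* (con 1ℚ :+ t)) refl

harmonic-step : ∀ s a {ρ π c} → 0ℚ ≤ ρ → 0ℚ ≤ π →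
                ρ * (fromℕ (s ℕ.+ a) - π * fromℕ s) ≤ c →
                harmonic a * c ≤ harmonic (s ℕ.+ a) * c + (harmonic (s ℕ.+ a) * π - 1ℚ) * (ρ * fromℕ s)
harmonic-step s a {ρ} {π} {c} 0≤ρ 0≤π ρ[t-πs]≤c =
  ≤-by-slack (D * (c - ρ * (t - π * σ)) + ρ * (D * t - σ) + ρ * π * σ * Hₐ)
    (+-nonNeg (+-nonNeg (*-nonNeg 0≤D (p≤q⇒0≤q-p ρ[t-πs]≤c))
                        (*-nonNeg 0≤ρ (p≤q⇒0≤q-p (harmonic-gap s a))))
              (*-nonNeg (*-nonNeg (*-nonNeg 0≤ρ 0≤π) (fromℕ-nonNeg s)) (harmonic-nonNeg a)))
    (identity H Hₐ c ρ π σ t)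
  where
  H = harmonic (s ℕ.+ a)
  Hₐ = harmonic a
  D = H - Hₐ
  σ = fromℕ s
  t = fromℕ (s ℕ.+ a)
  0≤D : 0ℚ ≤ D
  0≤D = p≤q⇒0≤q-p (harmonic-mono s a)
  identity : ∀ H Hₐ c ρ π σ t →
    Hₐ * c + ((H - Hₐ) * (c - ρ * (t - π * σ)) + ρ * ((H - Hₐ) * t - σ) + ρ * π * σ * Hₐ)
      ≡ H * c + (H * π - 1ℚ) * (ρ * σ)
  identity = solve 7 (λ H Hₐ c ρ π σ t →
    Hₐ :* c :+ ((H :- Hₐ) :* (c :- ρ :* (t :- π :* σ)) :+ ρ :* ((H :- Hₐ) :* t :- σ) :+ ρ :* π :* σ :* Hₐ)
      := H :* c :+ (H :* π :- con 1ℚ) :* (ρ :* σ)) refl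

∑ˡ : {A : Set} → List A → (A → ℚ) → ℚ
∑ˡ xs f = sumℚ (map f xs)

module _ {A : Set} where

  ∑ˡ-cong : ∀ xs {f g : A → ℚ} → (∀ x → f x ≡ g x) → ∑ˡ xs f ≡ ∑ˡ xs g
  ∑ˡ-cong []       f≗g = refl
  ∑ˡ-cong (x ∷ xs) f≗g = cong₂ _+_ (f≗g x) (∑ˡ-cong xs f≗g)

  ∑ˡ-+ : ∀ xs (f g : A → ℚ) → ∑ˡ xs (λ x → f x + g x) ≡ ∑ˡ xs f + ∑ˡ xs g
  ∑ˡ-+ []       f g = sym (ℚP.+-identityˡ 0ℚ)
  ∑ˡ-+ (x ∷ xs) f g = trans (cong (_+_ (f x + g x)) (∑ˡ-+ xs f g))
    (interchange (f x) (g x) (∑ˡ xs f) (∑ˡ xs g))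

  ∑ˡ-* : ∀ xs c (f : A → ℚ) → ∑ˡ xs (λ x → c * f x) ≡ c * ∑ˡ xs f
  ∑ˡ-* []       c f = sym (ℚP.*-zeroʳ c)
  ∑ˡ-* (x ∷ xs) c f = trans (cong (_+_ (c * f x)) (∑ˡ-* xs c f)) (sym (ℚP.*-distribˡ-+ c (f x) _))

  ∑ˡ-weighted : ∀ xs (w f g : A → ℚ) a b →
    ∑ˡ xs (λ x → w x * (a * f x + b * g x)) ≡ a * ∑ˡ xs (λ x → w x * f x) + b * ∑ˡ xs (λ x → w x * g x)
  ∑ˡ-weighted xs w f g a b = begin
    ∑ˡ xs (λ x → w x * (a * f x + b * g x))
      ≡⟨ ∑ˡ-cong xs (λ x → distrib (w x) (f x) (g x) a b) ⟩
    ∑ˡ xs (λ x → a * (w x * f x) + b * (w x * g x))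
      ≡⟨ ∑ˡ-+ xs _ _ ⟩
    ∑ˡ xs (λ x → a * (w x * f x)) + ∑ˡ xs (λ x → b * (w x * g x))
      ≡⟨ cong₂ _+_ (∑ˡ-* xs a _) (∑ˡ-* xs b _) ⟩
    a * ∑ˡ xs (λ x → w x * f x) + b * ∑ˡ xs (λ x → w x * g x) ∎
    where
    open ≡-Reasoning
    distrib : ∀ w f g a b → w * (a * f + b * g) ≡ a * (w * f) + b * (w * g)
    distrib = solve 5 (λ w f g a b → w :* (a :* f :+ b :* g) := a :* (w :* f) :+ b :* (w :* g)) refl

  ∑ˡ-mono : ∀ xs {f g : A → ℚ} → (∀ x → f x ≤ g x) → ∑ˡ xs f ≤ ∑ˡ xs g
  ∑ˡ-mono []       f≤g = ℚP.≤-refl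
  ∑ˡ-mono (x ∷ xs) f≤g = ℚP.+-mono-≤ (f≤g x) (∑ˡ-mono xs f≤g)

  ∑ˡ-nonNeg : ∀ xs {f : A → ℚ} → (∀ x → 0ℚ ≤ f x) → 0ℚ ≤ ∑ˡ xs f
  ∑ˡ-nonNeg []       0≤f = ℚP.≤-refl
  ∑ˡ-nonNeg (x ∷ xs) 0≤f = +-nonNeg (0≤f x) (∑ˡ-nonNeg xs 0≤f)

  ∑ˡ-≥-term : ∀ {xs x} {f : A → ℚ} → (∀ y → 0ℚ ≤ f y) → x ∈ xs → f x ≤ ∑ˡ xs f
  ∑ˡ-≥-term {x ∷ xs} 0≤f (here refl) = ≤-by-slack _ (∑ˡ-nonNeg xs 0≤f) refl
  ∑ˡ-≥-term {y ∷ xs} {f = f} 0≤f (there x∈xs) =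
    subst (_≤ ∑ˡ (y ∷ xs) f) (ℚP.+-identityˡ _) (ℚP.+-mono-≤ (0≤f y) (∑ˡ-≥-term 0≤f x∈xs))

  ∑ˡ-++ : ∀ xs ys (f : A → ℚ) → ∑ˡ (xs ++ ys) f ≡ ∑ˡ xs f + ∑ˡ ys f
  ∑ˡ-++ []       ys f = sym (ℚP.+-identityˡ _)
  ∑ˡ-++ (x ∷ xs) ys f = trans (cong (_+_ (f x)) (∑ˡ-++ xs ys f)) (sym (ℚP.+-assoc (f x) _ _))

  ∑ˡ-concatMap : {B : Set} (h : B → List A) → ∀ xs (f : A → ℚ) →
                 ∑ˡ (concatMap h xs) f ≡ ∑ˡ xs (λ y → ∑ˡ (h y) f)
  ∑ˡ-concatMap h []       f = refl
  ∑ˡ-concatMap h (y ∷ ys) f =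
    trans (∑ˡ-++ (h y) (concatMap h ys) f) (cong (_+_ (∑ˡ (h y) f)) (∑ˡ-concatMap h ys f))

  ∑ˡ-map : {B : Set} (g : B → A) → ∀ xs (f : A → ℚ) → ∑ˡ (map g xs) f ≡ ∑ˡ xs (f ∘ g)
  ∑ˡ-map g []       f = refl
  ∑ˡ-map g (y ∷ ys) f = cong (_+_ (f (g y))) (∑ˡ-map g ys f)

sumFin≡sum : ∀ n (f : Fin n → ℚ) → sumFin n f ≡ sum f
sumFin≡sum zero    f = refl
sumFin≡sum (suc n) f = cong (_+_ (f zero)) (sumFin≡sum n (f ∘ suc))

sumFin-cong : ∀ n {f g : Fin n → ℚ} → (∀ i → f i ≡ g i) → sumFin n f ≡ sumFin n g
sumFin-cong zero    f≗g = refl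
sumFin-cong (suc n) f≗g = cong₂ _+_ (f≗g zero) (sumFin-cong n (f≗g ∘ suc))

sumFin-zero : ∀ n → sumFin n (λ _ → 0ℚ) ≡ 0ℚ
sumFin-zero n = trans (sumFin≡sum n _) (sum-replicate-zero n)

sumFin-+ : ∀ n (f g : Fin n → ℚ) → sumFin n (λ i → f i + g i) ≡ sumFin n f + sumFin n g
sumFin-+ n f g = begin
  sumFin n (λ i → f i + g i)  ≡⟨ sumFin≡sum n _ ⟩
  sum (λ i → f i + g i)       ≡⟨ ∑-distrib-+ f g ⟩
  sum f + sum g               ≡⟨ sym (cong₂ _+_ (sumFin≡sum n f) (sumFin≡sum n g)) ⟩
  sumFin n f + sumFin n g     ∎
  where open ≡-Reasoning

sumFin-* : ∀ n c (f : Fin n → ℚ) → sumFin n (λ i → c * f i) ≡ c * sumFin n f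
sumFin-* n c f = begin
  sumFin n (λ i → c * f i)  ≡⟨ sumFin≡sum n _ ⟩
  sum (λ i → c * f i)       ≡⟨ sym (*-distribˡ-sum c f) ⟩
  c * sum f                 ≡⟨ cong (c *_) (sym (sumFin≡sum n f)) ⟩
  c * sumFin n f            ∎
  where open ≡-Reasoning

sumFin-comm : ∀ n k (f : Fin n → Fin k → ℚ) →
              sumFin n (λ i → sumFin k (f i)) ≡ sumFin k (λ j → sumFin n (λ i → f i j))
sumFin-comm n k f = begin
  sumFin n (λ i → sumFin k (f i))          ≡⟨ double-sum n k f ⟩
  sum (λ i → sum (f i))                    ≡⟨ ∑-comm f ⟩
  sum (λ j → sum (λ i → f i j))            ≡⟨ sym (double-sum k n (λ j i → f i j)) ⟩
  sumFin k (λ j → sumFin n (λ i → f i j))  ∎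
  where
  open ≡-Reasoning
  double-sum : ∀ n k (f : Fin n → Fin k → ℚ) → sumFin n (λ i → sumFin k (f i)) ≡ sum (λ i → sum (f i))
  double-sum n k f = trans (sumFin-cong n (λ i → sumFin≡sum k (f i))) (sumFin≡sum n _)

sumFin-mono : ∀ n {f g : Fin n → ℚ} → (∀ i → f i ≤ g i) → sumFin n f ≤ sumFin n g
sumFin-mono zero    f≤g = ℚP.≤-refl
sumFin-mono (suc n) f≤g = ℚP.+-mono-≤ (f≤g zero) (sumFin-mono n (f≤g ∘ suc))

sumFin-nonNeg : ∀ n {f : Fin n → ℚ} → (∀ i → 0ℚ ≤ f i) → 0ℚ ≤ sumFin n f
sumFin-nonNeg zero    0≤f = ℚP.≤-refl
sumFin-nonNeg (suc n) 0≤f = +-nonNeg (0≤f zero) (sumFin-nonNeg n (0≤f ∘ suc))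

sumFin-single : ∀ n {f : Fin n → ℚ} j → (∀ i → i ≢ j → f i ≡ 0ℚ) → sumFin n f ≡ f j
sumFin-single (suc n) {f} zero    f≡0 = trans
  (cong (_+_ (f zero)) (trans (sumFin-cong n (λ i → f≡0 (suc i) (λ ()))) (sumFin-zero n)))
  (ℚP.+-identityʳ (f zero))
sumFin-single (suc n) {f} (suc j) f≡0 = trans
  (cong (_+ sumFin n (f ∘ suc)) (f≡0 zero (λ ())))
  (trans (ℚP.+-identityˡ _) (sumFin-single n j (λ i i≢j → f≡0 (suc i) (i≢j ∘ FinP.suc-injective))))

sumFin-≥-term : ∀ n {f : Fin n → ℚ} j → (∀ i → 0ℚ ≤ f i) → f j ≤ sumFin n f
sumFin-≥-term (suc n) {f} zero    0≤f =
  ≤-by-slack _ (sumFin-nonNeg n (0≤f ∘ suc)) refl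
sumFin-≥-term (suc n) {f} (suc j) 0≤f = subst (_≤ sumFin (suc n) f) (ℚP.+-identityˡ (f (suc j)))
  (ℚP.+-mono-≤ (0≤f zero) (sumFin-≥-term n j (0≤f ∘ suc)))

sumFin-∑ˡ : ∀ n {A : Set} xs (f : Fin n → A → ℚ) →
            sumFin n (λ i → ∑ˡ xs (f i)) ≡ ∑ˡ xs (λ x → sumFin n (λ i → f i x))
sumFin-∑ˡ n []       f = sumFin-zero n
sumFin-∑ˡ n (x ∷ xs) f = trans (sumFin-+ n (λ i → f i x) (λ i → ∑ˡ xs (f i)))
  (cong (_+_ (sumFin n (λ i → f i x))) (sumFin-∑ˡ n xs f))

∑ˢ : {m : ℕ} → (Subset m → ℚ) → ℚ
∑ˢ {m} = ∑ˡ (allSubsets m)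

∑ˢ-suc : ∀ {m} (f : Subset (suc m) → ℚ) → ∑ˢ f ≡ ∑ˢ (λ S → f (true ∷ S) + (f (false ∷ S) + 0ℚ))
∑ˢ-suc {m} f = ∑ˡ-concatMap _ (allSubsets m) f

∈-allSubsets : ∀ {m} (S : Subset m) → S ∈ allSubsets m
∈-allSubsets []          = here refl
∈-allSubsets (true ∷ S)  = ∈-concatMap⁺ _ (Any.map (λ S≡T → here (cong (true ∷_) S≡T)) (∈-allSubsets S))
∈-allSubsets (false ∷ S) =
  ∈-concatMap⁺ _ (Any.map (λ S≡T → there (here (cong (false ∷_) S≡T))) (∈-allSubsets S))

_≟ˢ_ : {m : ℕ} → (S T : Subset m) → Dec (S ≡ T)
_≟ˢ_ = VecP.≡-dec Bool._≟_

δ : {m : ℕ} → Subset m → Subset m → ℚ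
δ S T = 𝟙 (does (T ≟ˢ S))

∑ˢ-δ : ∀ {m} (S : Subset m) (g : Subset m → ℚ) → ∑ˢ (λ T → δ S T * g T) ≡ g S
∑ˢ-δ {zero}  []          g = trans (ℚP.+-identityʳ _) (ℚP.*-identityˡ (g []))
∑ˢ-δ {suc m} (true ∷ S)  g = trans (∑ˢ-suc (λ T → δ (true ∷ S) T * g T))
  (trans (∑ˡ-cong (allSubsets m) drop-false) (∑ˢ-δ S (g ∘ (true ∷_))))
  where
  drop-false : ∀ T → δ S T * g (true ∷ T) + (0ℚ * g (false ∷ T) + 0ℚ) ≡ δ S T * g (true ∷ T)
  drop-false T = trans
    (cong (_+_ (δ S T * g (true ∷ T))) (trans (ℚP.+-identityʳ _) (ℚP.*-zeroˡ (g (false ∷ T)))))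
    (ℚP.+-identityʳ _)
∑ˢ-δ {suc m} (false ∷ S) g = trans (∑ˢ-suc (λ T → δ (false ∷ S) T * g T))
  (trans (∑ˡ-cong (allSubsets m) drop-true) (∑ˢ-δ S (g ∘ (false ∷_))))
  where
  drop-true : ∀ T → 0ℚ * g (true ∷ T) + (δ S T * g (false ∷ T) + 0ℚ) ≡ δ S T * g (false ∷ T)
  drop-true T = trans (cong (_+ (δ S T * g (false ∷ T) + 0ℚ)) (ℚP.*-zeroˡ (g (true ∷ T))))
                      (trans (ℚP.+-identityˡ _) (ℚP.+-identityʳ _))

∑ˢ-δ≡1 : ∀ {m} (S : Subset m) → ∑ˢ (δ S) ≡ 1ℚ
∑ˢ-δ≡1 S = trans (∑ˡ-cong (allSubsets _) (λ T → sym (ℚP.*-identityʳ (δ S T)))) (∑ˢ-δ S (λ _ → 1ℚ))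

δ-nonNeg : ∀ {m} (S T : Subset m) → 0ℚ ≤ δ S T
δ-nonNeg S T = 𝟙-nonNeg (does (T ≟ˢ S))

δ-support : ∀ {m} (S T : Subset m) → 0ℚ < δ S T → T ≡ S
δ-support S T = witness (T ≟ˢ S)
  where
  witness : ∀ {A : Set} (A? : Dec A) → 0ℚ < 𝟙 (does A?) → A
  witness (yes a) _   = a
  witness (no _)  0<0 = ⊥-elim (ℚP.<-irrefl refl 0<0)

-- Expectation under a product law, one item at a time

Law : ℕ → ℕ → Set
Law n m = Fin n → Subset m → ℚ

NonNegLaw : {n m : ℕ} → Law n m → Set
NonNegLaw p = ∀ F S → 0ℚ ≤ p F S

record IsLaw {n m : ℕ} (p : Law n m) : Set where
  field
    nonNeg : NonNegLaw p
    total  : ∀ F → ∑ˢ (p F) ≡ 1ℚ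

InSupport : {n m : ℕ} → Law n m → Realization n m → Set
InSupport {n} p ω = ∀ (F : Fin n) → 0ℚ < p F (lookup ω F)

𝔼′ : {n m : ℕ} → Law n m → (Realization n m → ℚ) → ℚ
𝔼′ {zero}  p X = X []
𝔼′ {suc n} p X = 𝔼′ (p ∘ suc) (λ ω → ∑ˢ (λ S → p zero S * X (S ∷ ω)))

tail-isLaw : ∀ {n m} {p : Law (suc n) m} → IsLaw p → IsLaw (p ∘ suc)
tail-isLaw law = record { nonNeg = nonNeg ∘ suc ; total = total ∘ suc }
  where open IsLaw law

𝔼′-cong : ∀ {n m} (p : Law n m) {X Y} → (∀ ω → X ω ≡ Y ω) → 𝔼′ p X ≡ 𝔼′ p Y
𝔼′-cong {zero}  p X≗Y = X≗Y []
𝔼′-cong {suc n} {m} p X≗Y =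
  𝔼′-cong (p ∘ suc) (λ ω → ∑ˡ-cong (allSubsets m) (λ S → cong (p zero S *_) (X≗Y (S ∷ ω))))

𝔼′-+ : ∀ {n m} (p : Law n m) X Y → 𝔼′ p (λ ω → X ω + Y ω) ≡ 𝔼′ p X + 𝔼′ p Y
𝔼′-+ {zero}  p X Y = refl
𝔼′-+ {suc n} {m} p X Y = trans
  (𝔼′-cong (p ∘ suc) (λ ω → trans
    (∑ˡ-cong (allSubsets m) (λ S → ℚP.*-distribˡ-+ (p zero S) (X (S ∷ ω)) (Y (S ∷ ω))))
    (∑ˡ-+ (allSubsets m) (λ S → p zero S * X (S ∷ ω)) (λ S → p zero S * Y (S ∷ ω)))))
  (𝔼′-+ (p ∘ suc) _ _)

𝔼′-* : ∀ {n m} (p : Law n m) c X → 𝔼′ p (λ ω → c * X ω) ≡ c * 𝔼′ p X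
𝔼′-* {zero}  p c X = refl
𝔼′-* {suc n} {m} p c X = trans
  (𝔼′-cong (p ∘ suc) (λ ω → trans (∑ˡ-cong (allSubsets m) (λ S → swap (p zero S) c (X (S ∷ ω))))
                                  (∑ˡ-* (allSubsets m) c (λ S → p zero S * X (S ∷ ω)))))
  (𝔼′-* (p ∘ suc) c _)
  where
  swap : ∀ a c x → a * (c * x) ≡ c * (a * x)
  swap = solve 3 (λ a c x → a :* (c :* x) := c :* (a :* x)) refl

𝔼′-zero : ∀ {n m} (p : Law n m) → 𝔼′ p (λ _ → 0ℚ) ≡ 0ℚ
𝔼′-zero p = trans (𝔼′-cong p (λ _ → sym (ℚP.*-zeroˡ 0ℚ)))
                  (trans (𝔼′-* p 0ℚ (λ _ → 0ℚ)) (ℚP.*-zeroˡ (𝔼′ p (λ _ → 0ℚ))))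

𝔼′-∑ˡ : ∀ {n m} (p : Law n m) {A : Set} xs (f : A → Realization n m → ℚ) →
        𝔼′ p (λ ω → ∑ˡ xs (λ x → f x ω)) ≡ ∑ˡ xs (λ x → 𝔼′ p (f x))
𝔼′-∑ˡ p []       f = 𝔼′-zero p
𝔼′-∑ˡ p (x ∷ xs) f = trans (𝔼′-+ p (f x) _) (cong (_+_ (𝔼′ p (f x))) (𝔼′-∑ˡ p xs f))

𝔼′-sumFin : ∀ {n m} (p : Law n m) k (f : Fin k → Realization n m → ℚ) →
            𝔼′ p (λ ω → sumFin k (λ j → f j ω)) ≡ sumFin k (λ j → 𝔼′ p (f j))
𝔼′-sumFin p zero    f = 𝔼′-zero p
𝔼′-sumFin p (suc k) f = trans (𝔼′-+ p (f zero) _) (cong (_+_ (𝔼′ p (f zero))) (𝔼′-sumFin p k (f ∘ suc)))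

𝔼′-const : ∀ {n m} {p : Law n m} → IsLaw p → ∀ c → 𝔼′ p (λ _ → c) ≡ c
𝔼′-const {zero}          law c = refl
𝔼′-const {suc n} {m} {p} law c = trans
  (𝔼′-cong (p ∘ suc) (λ ω → trans (∑ˡ-cong (allSubsets m) (λ S → ℚP.*-comm (p zero S) c))
                      (trans (∑ˡ-* (allSubsets m) c (p zero))
                      (trans (cong (c *_) (IsLaw.total law zero)) (ℚP.*-identityʳ c)))))
  (𝔼′-const (tail-isLaw law) c)

𝔼′-affine : ∀ {n m} {p : Law n m} → IsLaw p → ∀ a X b → 𝔼′ p (λ ω → a - X ω * b) ≡ a - 𝔼′ p X * b
𝔼′-affine {p = p} law a X b = begin
  𝔼′ p (λ ω → a - X ω * b)                ≡⟨ 𝔼′-cong p (λ ω → to-scaled a (X ω) b) ⟩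
  𝔼′ p (λ ω → a + (- b) * X ω)            ≡⟨ 𝔼′-+ p (λ _ → a) _ ⟩
  𝔼′ p (λ _ → a) + 𝔼′ p (λ ω → (- b) * X ω) ≡⟨ cong₂ _+_ (𝔼′-const law a) (𝔼′-* p (- b) X) ⟩
  a + (- b) * 𝔼′ p X                      ≡⟨ sym (to-scaled a (𝔼′ p X) b) ⟩
  a - 𝔼′ p X * b                          ∎
  where
  open ≡-Reasoning
  to-scaled : ∀ a x b → a - x * b ≡ a + (- b) * x
  to-scaled = solve 3 (λ a x b → a :- x :* b := a :+ (:- b) :* x) refl

𝔼′-mono : ∀ {n m} {p : Law n m} → NonNegLaw p → ∀ {X Y} →
          (∀ ω → InSupport p ω → X ω ≤ Y ω) → 𝔼′ p X ≤ 𝔼′ p Y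
𝔼′-mono {zero}          0≤p X≤Y = X≤Y [] (λ ())
𝔼′-mono {suc n} {m} {p} 0≤p {X} {Y} X≤Y =
  𝔼′-mono (0≤p ∘ suc) (λ ω ω∈supp → ∑ˡ-mono (allSubsets m) (λ S →
    scale-≤-if-pos (0≤p zero S) (λ 0<pS → X≤Y (S ∷ ω) λ { zero → 0<pS ; (suc F) → ω∈supp F })))

𝔼′-cong-support : ∀ {n m} {p : Law n m} → NonNegLaw p → ∀ {X Y} →
                  (∀ ω → InSupport p ω → X ω ≡ Y ω) → 𝔼′ p X ≡ 𝔼′ p Y
𝔼′-cong-support 0≤p X≡Y = ℚP.≤-antisym (𝔼′-mono 0≤p (λ ω s → ℚP.≤-reflexive (X≡Y ω s)))
                                        (𝔼′-mono 0≤p (λ ω s → ℚP.≤-reflexive (sym (X≡Y ω s))))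

𝔼′-nonNeg : ∀ {n m} {p : Law n m} → NonNegLaw p → ∀ {X} →
            (∀ ω → InSupport p ω → 0ℚ ≤ X ω) → 0ℚ ≤ 𝔼′ p X
𝔼′-nonNeg {p = p} 0≤p {X} 0≤X = subst (_≤ 𝔼′ p X) (𝔼′-zero p) (𝔼′-mono 0≤p 0≤X)

𝔼′≡0⇒≡0 : ∀ {n m} {p : Law n m} → NonNegLaw p → ∀ X → (∀ ω → 0ℚ ≤ X ω) →
          𝔼′ p X ≡ 0ℚ → ∀ ω → InSupport p ω → X ω ≡ 0ℚ
𝔼′≡0⇒≡0 {zero}          0≤p X 0≤X 𝔼X≡0 [] _ = 𝔼X≡0
𝔼′≡0⇒≡0 {suc n} {m} {p} 0≤p X 0≤X 𝔼X≡0 (S ∷ ω) ω∈supp = ℚP.≤-antisym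
  (ℚP.*-cancelˡ-≤-pos (p zero S) {{positive (ω∈supp zero)}}
    (subst₂ _≤_ refl (sym (ℚP.*-zeroʳ (p zero S)))
      (subst (p zero S * X (S ∷ ω) ≤_) marginal≡0 (∑ˡ-≥-term 0≤weighted (∈-allSubsets S)))))
  (0≤X (S ∷ ω))
  where
  0≤weighted : ∀ T → 0ℚ ≤ p zero T * X (T ∷ ω)
  0≤weighted T = *-nonNeg (0≤p zero T) (0≤X (T ∷ ω))
  marginal≡0 : ∑ˢ (λ T → p zero T * X (T ∷ ω)) ≡ 0ℚ
  marginal≡0 = 𝔼′≡0⇒≡0 (0≤p ∘ suc) _
    (λ ω′ → ∑ˡ-nonNeg (allSubsets m) (λ T → *-nonNeg (0≤p zero T) (0≤X (T ∷ ω′))))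
    𝔼X≡0 ω (ω∈supp ∘ suc)

condition : {n m : ℕ} → Law n m → Fin n → Subset m → Law n m
condition p F S = updateAt p F (λ _ → δ S)

module _ {n m : ℕ} (p : Law n m) (F : Fin n) (S : Subset m) where

  condition-elim : (P : (Subset m → ℚ) → Set) → P (δ S) → (∀ F′ → P (p F′)) →
                   ∀ F′ → P (condition p F S F′)
  condition-elim P Pδ Pp F′ with F′ ≟ F
  ... | yes refl = subst P (sym (VecFP.updateAt-updates F p)) Pδ
  ... | no F′≢F  = subst P (sym (VecFP.updateAt-minimal F′ F p F′≢F)) (Pp F′)

  condition-isLaw : IsLaw p → IsLaw (condition p F S)
  condition-isLaw law = record
    { nonNeg = condition-elim (λ r → ∀ T → 0ℚ ≤ r T) (δ-nonNeg S) nonNeg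
    ; total  = condition-elim (λ r → ∑ˢ r ≡ 1ℚ) (∑ˢ-δ≡1 S) total
    }
    where open IsLaw law

  condition-support-at : ∀ ω → InSupport (condition p F S) ω → lookup ω F ≡ S
  condition-support-at ω ω∈supp =
    δ-support S (lookup ω F) (subst (λ r → 0ℚ < r (lookup ω F)) (VecFP.updateAt-updates F p) (ω∈supp F))

  condition-support : 0ℚ < p F S → ∀ ω → InSupport (condition p F S) ω → InSupport p ω
  condition-support 0<pS ω ω∈supp F′ with F′ ≟ F
  ... | yes refl = subst (λ T → 0ℚ < p F T) (sym (condition-support-at ω ω∈supp)) 0<pS
  ... | no F′≢F  = subst (λ r → 0ℚ < r (lookup ω F′)) (VecFP.updateAt-minimal F′ F p F′≢F) (ω∈supp F′)

𝔼′-total : ∀ {n m} (p : Law n m) F X → 𝔼′ p X ≡ ∑ˢ (λ S → p F S * 𝔼′ (condition p F S) X)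
𝔼′-total {suc n} {m} p zero X = begin
  𝔼′ (p ∘ suc) (λ ω → ∑ˢ (λ S → p zero S * X (S ∷ ω)))
    ≡⟨ 𝔼′-∑ˡ (p ∘ suc) (allSubsets m) (λ S ω → p zero S * X (S ∷ ω)) ⟩
  ∑ˢ (λ S → 𝔼′ (p ∘ suc) (λ ω → p zero S * X (S ∷ ω)))
    ≡⟨ ∑ˡ-cong (allSubsets m) (λ S → 𝔼′-* (p ∘ suc) (p zero S) (λ ω → X (S ∷ ω))) ⟩
  ∑ˢ (λ S → p zero S * 𝔼′ (p ∘ suc) (λ ω → X (S ∷ ω)))
    ≡⟨ ∑ˡ-cong (allSubsets m) (λ S → cong (p zero S *_)
         (𝔼′-cong (p ∘ suc) (λ ω → sym (∑ˢ-δ S (λ T → X (T ∷ ω)))))) ⟩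
  ∑ˢ (λ S → p zero S * 𝔼′ (condition p zero S) X) ∎
  where open ≡-Reasoning
𝔼′-total {suc n} p (suc F) X = 𝔼′-total (p ∘ suc) F _

Ignores : {n m : ℕ} → (Realization n m → ℚ) → Fin n → Set
Ignores {m = m} X F = ∀ ω (T : Subset m) → X (ω [ F ]≔ T) ≡ X ω

𝔼′-condition-ignored : ∀ {n m} {p : Law n m} → IsLaw p → ∀ F S {X} → Ignores X F →
                       𝔼′ (condition p F S) X ≡ 𝔼′ p X
𝔼′-condition-ignored {suc n} {m} {p} law zero S {X} ignores = trans
  (𝔼′-cong (p ∘ suc) (λ ω → average (δ S) (∑ˢ-δ≡1 S) ω))
  (sym (𝔼′-cong (p ∘ suc) (λ ω → average (p zero) (IsLaw.total law zero) ω)))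
  where
  average : ∀ r → ∑ˢ r ≡ 1ℚ → ∀ ω → ∑ˢ (λ T → r T * X (T ∷ ω)) ≡ X (∅ ∷ ω)
  average r Σr≡1 ω = begin
    ∑ˢ (λ T → r T * X (T ∷ ω))   ≡⟨ ∑ˡ-cong (allSubsets m) (λ T → trans
                                       (cong (r T *_) (sym (ignores (T ∷ ω) _))) (ℚP.*-comm (r T) _)) ⟩
    ∑ˢ (λ T → x₀ * r T)          ≡⟨ ∑ˡ-* (allSubsets m) x₀ r ⟩
    x₀ * ∑ˢ r                    ≡⟨ trans (cong (x₀ *_) Σr≡1) (ℚP.*-identityʳ x₀) ⟩
    x₀                           ∎
    where
    open ≡-Reasoning
    x₀ = X (∅ ∷ ω)
𝔼′-condition-ignored {suc n} {p = p} law (suc F) S ignores =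
  𝔼′-condition-ignored (tail-isLaw law) F S
    (λ ω T → ∑ˡ-cong (allSubsets _) (λ S′ → cong (p zero S′ *_) (ignores (S′ ∷ ω) T)))

𝔼′-product : ∀ {n m} {p : Law n m} → IsLaw p → ∀ F {X} → Ignores X F → (g : Subset m → ℚ) →
             𝔼′ p (λ ω → X ω * g (lookup ω F)) ≡ 𝔼′ p X * ∑ˢ (λ T → p F T * g T)
𝔼′-product {m = m} {p} law F {X} ignores g = begin
  𝔼′ p (λ ω → X ω * g (lookup ω F))
    ≡⟨ 𝔼′-total p F _ ⟩
  ∑ˢ (λ S → p F S * 𝔼′ (condition p F S) (λ ω → X ω * g (lookup ω F)))
    ≡⟨ ∑ˡ-cong (allSubsets m) (λ S → cong (p F S *_) (conditioned S)) ⟩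
  ∑ˢ (λ S → p F S * (g S * 𝔼′ p X))
    ≡⟨ ∑ˡ-cong (allSubsets m) (λ S → regroup (p F S) (g S) (𝔼′ p X)) ⟩
  ∑ˢ (λ S → 𝔼′ p X * (p F S * g S))
    ≡⟨ ∑ˡ-* (allSubsets m) (𝔼′ p X) (λ T → p F T * g T) ⟩
  𝔼′ p X * ∑ˢ (λ T → p F T * g T) ∎
  where
  open ≡-Reasoning
  regroup : ∀ a b c → a * (b * c) ≡ c * (a * b)
  regroup = solve 3 (λ a b c → a :* (b :* c) := c :* (a :* b)) refl
  conditioned : ∀ S → 𝔼′ (condition p F S) (λ ω → X ω * g (lookup ω F)) ≡ g S * 𝔼′ p X
  conditioned S = begin
    𝔼′ (condition p F S) (λ ω → X ω * g (lookup ω F))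
      ≡⟨ 𝔼′-cong-support (IsLaw.nonNeg (condition-isLaw p F S law)) (λ ω ω∈supp →
           trans (cong (λ T → X ω * g T) (condition-support-at p F S ω ω∈supp)) (ℚP.*-comm (X ω) (g S))) ⟩
    𝔼′ (condition p F S) (λ ω → g S * X ω)
      ≡⟨ 𝔼′-* (condition p F S) (g S) X ⟩
    g S * 𝔼′ (condition p F S) X
      ≡⟨ cong (g S *_) (𝔼′-condition-ignored law F S ignores) ⟩
    g S * 𝔼′ p X ∎

𝔼≡𝔼′ : ∀ {n m} (p : Law n m) X → 𝔼 p X ≡ 𝔼′ p X
𝔼≡𝔼′ {zero}  p X = trans (ℚP.+-identityʳ _) (ℚP.*-identityˡ (X []))
𝔼≡𝔼′ {suc n} {m} p X = begin
  ∑ˡ (allRealizations (suc n) m) (λ ω → Pr p ω * X ω)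
    ≡⟨ ∑ˡ-concatMap (λ ω → map (_∷ ω) (allSubsets m)) (allRealizations n m) _ ⟩
  ∑ˡ (allRealizations n m) (λ ω → ∑ˡ (map (_∷ ω) (allSubsets m)) (λ ω′ → Pr p ω′ * X ω′))
    ≡⟨ ∑ˡ-cong (allRealizations n m) (λ ω → trans (∑ˡ-map (_∷ ω) (allSubsets m) _)
         (trans (∑ˡ-cong (allSubsets m) (λ S → regroup (p zero S) (Pr (p ∘ suc) ω) (X (S ∷ ω))))
                (∑ˡ-* (allSubsets m) (Pr (p ∘ suc) ω) _))) ⟩
  𝔼 (p ∘ suc) (λ ω → ∑ˢ (λ S → p zero S * X (S ∷ ω)))
    ≡⟨ 𝔼≡𝔼′ (p ∘ suc) _ ⟩
  𝔼′ p X ∎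
  where
  open ≡-Reasoning
  regroup : ∀ a b c → a * b * c ≡ b * (a * c)
  regroup = solve 3 (λ a b c → a :* b :* c := b :* (a :* c)) refl

almost-sure : ∀ {n m} {p : Law n m} → IsLaw p → (B : Realization n m → Bool) →
              Prob p B ≡ 1ℚ → ∀ ω → InSupport p ω → T (B ω)
almost-sure {p = p} law B PrB≡1 ω ω∈supp = by-cases (B ω) refl
  where
  open IsLaw law
  miss : Bool → ℚ
  miss b = 1ℚ + (- 1ℚ) * 𝟙 b
  0≤miss : ∀ b → 0ℚ ≤ miss b
  0≤miss true  = ℚP.≤-refl
  0≤miss false = 0≤1
  𝔼miss≡0 : 𝔼′ p (miss ∘ B) ≡ 0ℚ
  𝔼miss≡0 = begin
    𝔼′ p (miss ∘ B)                      ≡⟨ 𝔼′-+ p _ _ ⟩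
    𝔼′ p (λ _ → 1ℚ) + 𝔼′ p (λ ω → (- 1ℚ) * 𝟙 (B ω))
      ≡⟨ cong₂ _+_ (𝔼′-const law 1ℚ) (𝔼′-* p (- 1ℚ) (𝟙 ∘ B)) ⟩
    1ℚ + (- 1ℚ) * 𝔼′ p (𝟙 ∘ B)
      ≡⟨ cong (λ x → 1ℚ + (- 1ℚ) * x) (trans (sym (𝔼≡𝔼′ p (𝟙 ∘ B))) PrB≡1) ⟩
    1ℚ + (- 1ℚ) * 1ℚ                     ≡⟨⟩
    0ℚ                                   ∎
    where open ≡-Reasoning
  by-cases : ∀ b → B ω ≡ b → T (B ω)
  by-cases true  Bω≡true  = subst T (sym Bω≡true) _
  by-cases false Bω≡false = ⊥-elim (ℚP.1≢0 (trans (cong miss (sym Bω≡false))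
    (𝔼′≡0⇒≡0 (IsLaw.nonNeg law) (miss ∘ B) (0≤miss ∘ B) 𝔼miss≡0 ω ω∈supp)))

lookup-∪ : ∀ {m} (U V : Subset m) e → lookup (U ∪ V) e ≡ lookup U e ∨ lookup V e
lookup-∪ U V e = VecP.lookup-zipWith _∨_ e U V

lookup-∩ : ∀ {m} (U V : Subset m) e → lookup (U ∩ V) e ≡ lookup U e ∧ lookup V e
lookup-∩ U V e = VecP.lookup-zipWith _∧_ e U V

lookup-─ : ∀ {m} (U V : Subset m) e → lookup (U ─ V) e ≡ lookup U e ∧ not (lookup V e)
lookup-─ (u ∷ U) (true  ∷ V) zero    = sym (BoolP.∧-zeroʳ u)
lookup-─ (u ∷ U) (false ∷ V) zero    = sym (BoolP.∧-identityʳ u)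
lookup-─ (u ∷ U) (v ∷ V)     (suc e) = lookup-─ U V e

lookup-∅ : ∀ {m} (e : Fin m) → lookup ∅ e ≡ false
lookup-∅ e = VecP.lookup-replicate e false

lookup-full : ∀ {m} (e : Fin m) → lookup full e ≡ true
lookup-full e = VecP.lookup-replicate e true

lookup-⁅⁆ : ∀ {n} (F F′ : Fin n) → lookup ⁅ F ⁆ F′ ≡ does (F ≟ F′)
lookup-⁅⁆ zero    zero     = refl
lookup-⁅⁆ zero    (suc F′) = lookup-∅ F′
lookup-⁅⁆ (suc F) zero     = refl
lookup-⁅⁆ (suc F) (suc F′) = lookup-⁅⁆ F F′

lookup-∪⁅⁆ : ∀ {n} (E : Subset n) F F′ → lookup (E ∪ ⁅ F ⁆) F′ ≡ lookup E F′ ∨ does (F ≟ F′)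
lookup-∪⁅⁆ E F F′ = trans (lookup-∪ E ⁅ F ⁆ F′) (cong (lookup E F′ ∨_) (lookup-⁅⁆ F F′))

lookup-∪⁅⁆-self : ∀ {n} (E : Subset n) F → lookup (E ∪ ⁅ F ⁆) F ≡ true
lookup-∪⁅⁆-self E F =
  trans (lookup-∪⁅⁆ E F F) (trans (cong (lookup E F ∨_) (dec-true (F ≟ F) refl)) (BoolP.∨-zeroʳ _))

lookup-∪⁅⁆-other : ∀ {n} (E : Subset n) {F F′} → F′ ≢ F → lookup (E ∪ ⁅ F ⁆) F′ ≡ lookup E F′
lookup-∪⁅⁆-other E {F} {F′} F′≢F =
  trans (lookup-∪⁅⁆ E F F′)
    (trans (cong (lookup E F′ ∨_) (dec-false (F ≟ F′) (F′≢F ∘ sym))) (BoolP.∨-identityʳ _))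

lookup-∪-falseˡ : ∀ {n} (E E′ : Subset n) F → lookup (E ∪ E′) F ≡ false → lookup E F ≡ false
lookup-∪-falseˡ E E′ F E∪E′F≡false with lookup E F | lookup-∪ E E′ F
... | false | _  = refl
... | true  | eq = trans (sym eq) E∪E′F≡false

∉⇒lookup≡false : ∀ {n} {F : Fin n} {E} → F ∉ E → lookup E F ≡ false
∉⇒lookup≡false {F = F} {E} F∉E with lookup E F in eq
... | true  = ⊥-elim (F∉E (VecP.lookup⇒[]= F E eq))
... | false = refl

lookup≡false⇒∉ : ∀ {n} {F : Fin n} {E} → lookup E F ≡ false → F ∉ E
lookup≡false⇒∉ EF≡false F∈E with trans (sym (VecP.[]=⇒lookup F∈E)) EF≡false
... | ()

size : {m : ℕ} → Subset m → ℚ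
size W = fromℕ ∣ W ∣

size≡∑𝟙 : ∀ {m} (W : Subset m) → size W ≡ sumFin m (λ e → 𝟙 (lookup W e))
size≡∑𝟙 []          = refl
size≡∑𝟙 (true ∷ W)  = cong (_+_ 1ℚ) (size≡∑𝟙 W)
size≡∑𝟙 (false ∷ W) = trans (size≡∑𝟙 W) (sym (ℚP.+-identityˡ _))

size-nonNeg : ∀ {m} (W : Subset m) → 0ℚ ≤ size W
size-nonNeg W = fromℕ-nonNeg ∣ W ∣

∣∣-split : ∀ {m} (U S : Subset m) → ∣ U ∣ ≡ ∣ U ∩ S ∣ ℕ.+ ∣ U ─ S ∣
∣∣-split []          []          = refl
∣∣-split (true  ∷ U) (true  ∷ S) = cong suc (∣∣-split U S)
∣∣-split (true  ∷ U) (false ∷ S) = trans (cong suc (∣∣-split U S)) (sym (ℕP.+-suc _ _))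
∣∣-split (false ∷ U) (true  ∷ S) = ∣∣-split U S
∣∣-split (false ∷ U) (false ∷ S) = ∣∣-split U S

Disjoint : {m : ℕ} → Subset m → Subset m → Set
Disjoint U V = ∀ e → lookup U e ∧ lookup V e ≡ false

Disjoint⇒size≡0 : ∀ {m} {U V : Subset m} → Disjoint U V → size (U ∩ V) ≡ 0ℚ
Disjoint⇒size≡0 {m} {U} {V} U∩V≡∅ = begin
  size (U ∩ V)
    ≡⟨ size≡∑𝟙 (U ∩ V) ⟩
  sumFin m (λ e → 𝟙 (lookup (U ∩ V) e))
    ≡⟨ sumFin-cong m (λ e → cong 𝟙 (trans (lookup-∩ U V e) (U∩V≡∅ e))) ⟩
  sumFin m (λ _ → 0ℚ)
    ≡⟨ sumFin-zero m ⟩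
  0ℚ ∎
  where open ≡-Reasoning

Disjoint-─ˡ : ∀ {m} (U S : Subset m) {V} → Disjoint U V → Disjoint (U ─ S) V
Disjoint-─ˡ U S {V} U∩V≡∅ e = trans (cong (_∧ lookup V e) (lookup-─ U S e))
  (shrink (lookup U e) (lookup S e) (lookup V e) (U∩V≡∅ e))
  where
  shrink : ∀ u s v → u ∧ v ≡ false → (u ∧ not s) ∧ v ≡ false
  shrink false s v _ = refl
  shrink true  s v v≡false rewrite v≡false = BoolP.∧-zeroʳ (not s)

Disjoint-─ : ∀ {m} (U S : Subset m) → Disjoint (U ─ S) S
Disjoint-─ U S e = trans (cong (_∧ lookup S e) (lookup-─ U S e)) (removed (lookup U e) (lookup S e))
  where
  removed : ∀ u s → (u ∧ not s) ∧ s ≡ false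
  removed false s     = refl
  removed true  false = refl
  removed true  true  = refl

-- Decision trees

module _ {n m : ℕ} where

  evaluates : Tree n m → Realization n m → Fin n → Bool
  evaluates stop        ω F = false
  evaluates (eval F′ k) ω F = does (F′ ≟ F) ∨ evaluates (k (lookup ω F′)) ω F

  covers : Tree n m → Realization n m → Fin m → Bool
  covers stop        ω e = false
  covers (eval F′ k) ω e = lookup (lookup ω F′) e ∨ covers (k (lookup ω F′)) ω e

  lookup-evaluatedFrom : ∀ T ω acc F → lookup (evaluatedFrom T ω acc) F ≡ lookup acc F ∨ evaluates T ω F
  lookup-evaluatedFrom stop        ω acc F = sym (BoolP.∨-identityʳ _)
  lookup-evaluatedFrom (eval F′ k) ω acc F = begin
    lookup (evaluatedFrom (k (lookup ω F′)) ω (acc ∪ ⁅ F′ ⁆)) F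
      ≡⟨ lookup-evaluatedFrom (k (lookup ω F′)) ω (acc ∪ ⁅ F′ ⁆) F ⟩
    lookup (acc ∪ ⁅ F′ ⁆) F ∨ evaluates (k (lookup ω F′)) ω F
      ≡⟨ cong (_∨ evaluates (k (lookup ω F′)) ω F) (lookup-∪⁅⁆ acc F′ F) ⟩
    (lookup acc F ∨ does (F′ ≟ F)) ∨ evaluates (k (lookup ω F′)) ω F
      ≡⟨ BoolP.∨-assoc (lookup acc F) _ _ ⟩
    lookup acc F ∨ evaluates (eval F′ k) ω F ∎
    where open ≡-Reasoning

  lookup-coveredFrom : ∀ T ω acc e → lookup (coveredFrom T ω acc) e ≡ lookup acc e ∨ covers T ω e
  lookup-coveredFrom stop        ω acc e = sym (BoolP.∨-identityʳ _)
  lookup-coveredFrom (eval F′ k) ω acc e = trans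
    (lookup-coveredFrom (k (lookup ω F′)) ω (acc ∪ lookup ω F′) e)
    (trans (cong (_∨ covers (k (lookup ω F′)) ω e) (lookup-∪ acc (lookup ω F′) e))
           (BoolP.∨-assoc (lookup acc e) _ _))

  lookup-evaluated : ∀ T ω F → lookup (evaluated T ω) F ≡ evaluates T ω F
  lookup-evaluated T ω F = trans (lookup-evaluatedFrom T ω ∅ F) (cong (_∨ evaluates T ω F) (lookup-∅ F))

  lookup-covered : ∀ T ω e → lookup (covered T ω) e ≡ covers T ω e
  lookup-covered T ω e = trans (lookup-coveredFrom T ω ∅ e) (cong (_∨ covers T ω e) (lookup-∅ e))

  covers⇒evaluates : ∀ T ω e → covers T ω e ≡ true →
                     ∃ λ F → evaluates T ω F ≡ true × lookup (lookup ω F) e ≡ true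
  covers⇒evaluates (eval F′ k) ω e covered with lookup (lookup ω F′) e in eq
  ... | true  = F′ , cong (_∨ evaluates (k (lookup ω F′)) ω F′) (dec-true (F′ ≟ F′) refl) , eq
  ... | false with covers⇒evaluates (k (lookup ω F′)) ω e covered
  ...   | F , evaluatesF , e∈ωF = F , trans (cong (_ ∨_) evaluatesF) (BoolP.∨-zeroʳ _) , e∈ωF

  evaluates-oblivious : ∀ T ω F S → evaluates T (ω [ F ]≔ S) F ≡ evaluates T ω F
  evaluates-oblivious stop        ω F S = refl
  evaluates-oblivious (eval F′ k) ω F S with F′ ≟ F
  ... | yes refl = refl
  ... | no F′≢F rewrite VecP.lookup∘update′ F′≢F ω S = evaluates-oblivious (k (lookup ω F′)) ω F S

module _ {n m : ℕ} where

  ∑evalOutside : Subset n → Tree n m → Realization n m → (Fin n → ℚ) → ℚ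
  ∑evalOutside E T ω w = sumFin n (λ F → 𝟙 (evaluates T ω F ∧ not (lookup E F)) * w F)

  ∑evalOutside-all : ∀ E T ω (w : Fin n → ℚ) → (∀ F → lookup E F ≡ true → w F ≡ 0ℚ) →
                     sumFin n (λ F → 𝟙 (evaluates T ω F) * w F) ≡ ∑evalOutside E T ω w
  ∑evalOutside-all E T ω w w≡0 = sumFin-cong n (λ F → term (evaluates T ω F) (lookup E F) refl)
    where
    term : ∀ {F} b e → lookup E F ≡ e → 𝟙 b * w F ≡ 𝟙 (b ∧ not e) * w F
    term {F} b false _    = cong (λ b → 𝟙 b * w F) (sym (BoolP.∧-identityʳ b))
    term {F} b true  EF≡e = trans (cong (𝟙 b *_) (w≡0 F EF≡e))
      (trans (ℚP.*-zeroʳ (𝟙 b)) (sym (trans (cong (λ b → 𝟙 b * w F) (BoolP.∧-zeroʳ b)) (ℚP.*-zeroˡ (w F)))))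

  ∑evalOutside-split : ∀ E F T ω (w : Fin n → ℚ) → lookup E F ≡ false →
    ∑evalOutside E T ω w ≡ ∑evalOutside (E ∪ ⁅ F ⁆) T ω w + 𝟙 (evaluates T ω F) * w F
  ∑evalOutside-split E F T ω w EF≡false = begin
    ∑evalOutside E T ω w
      ≡⟨ sumFin-cong n (λ F′ → trans (cong (_* w F′) (𝟙-split (b F′) (lookup E F′) (d F′) (d⇒∉E F′)))
           (ℚP.*-distribʳ-+ (w F′) (𝟙 (b F′ ∧ not (lookup E F′ ∨ d F′))) (𝟙 (b F′ ∧ d F′)))) ⟩
    sumFin n (λ F′ → 𝟙 (b F′ ∧ not (lookup E F′ ∨ d F′)) * w F′ + 𝟙 (b F′ ∧ d F′) * w F′)
      ≡⟨ sumFin-+ n _ _ ⟩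
    sumFin n (λ F′ → 𝟙 (b F′ ∧ not (lookup E F′ ∨ d F′)) * w F′) + sumFin n (λ F′ → 𝟙 (b F′ ∧ d F′) * w F′)
      ≡⟨ cong₂ _+_ (sumFin-cong n (λ F′ → cong (λ e → 𝟙 (b F′ ∧ not e) * w F′) (sym (lookup-∪⁅⁆ E F F′))))
                   (sumFin-single n F only-F) ⟩
    ∑evalOutside (E ∪ ⁅ F ⁆) T ω w + 𝟙 (b F ∧ d F) * w F
      ≡⟨ cong (λ x → ∑evalOutside (E ∪ ⁅ F ⁆) T ω w + 𝟙 (b F ∧ x) * w F) (dec-true (F ≟ F) refl) ⟩
    ∑evalOutside (E ∪ ⁅ F ⁆) T ω w + 𝟙 (b F ∧ true) * w F
      ≡⟨ cong (λ x → ∑evalOutside (E ∪ ⁅ F ⁆) T ω w + 𝟙 x * w F) (BoolP.∧-identityʳ (b F)) ⟩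
    ∑evalOutside (E ∪ ⁅ F ⁆) T ω w + 𝟙 (b F) * w F ∎
    where
    open ≡-Reasoning
    b = evaluates T ω
    d = λ F′ → does (F ≟ F′)
    𝟙-split : ∀ b e d → (d ≡ true → e ≡ false) → 𝟙 (b ∧ not e) ≡ 𝟙 (b ∧ not (e ∨ d)) + 𝟙 (b ∧ d)
    𝟙-split false e     d     _ = refl
    𝟙-split true  false false _ = refl
    𝟙-split true  false true  _ = refl
    𝟙-split true  true  false _ = refl
    𝟙-split true  true  true  d⇒¬e with d⇒¬e refl
    ... | ()
    d⇒∉E : ∀ F′ → d F′ ≡ true → lookup E F′ ≡ false
    d⇒∉E F′ dF′ with F ≟ F′
    ... | yes refl = EF≡false
    d⇒∉E F′ () | no _
    only-F : ∀ F′ → F′ ≢ F → 𝟙 (b F′ ∧ d F′) * w F′ ≡ 0ℚ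
    only-F F′ F′≢F = trans (cong (λ x → 𝟙 (b F′ ∧ x) * w F′) (dec-false (F ≟ F′) (F′≢F ∘ sym)))
      (trans (cong (λ x → 𝟙 x * w F′) (BoolP.∧-zeroʳ (b F′))) (ℚP.*-zeroˡ (w F′)))

  ∑evalOutside-mono : ∀ E T ω {w w′ : Fin n → ℚ} → (∀ F → lookup E F ≡ false → w F ≤ w′ F) →
                      ∑evalOutside E T ω w ≤ ∑evalOutside E T ω w′
  ∑evalOutside-mono E T ω {w} {w′} w≤w′ = sumFin-mono n (λ F → term (evaluates T ω F) (lookup E F) refl)
    where
    term : ∀ {F} b e → lookup E F ≡ e → 𝟙 (b ∧ not e) * w F ≤ 𝟙 (b ∧ not e) * w′ F
    term {F} b false EF≡false = scale-≤ (𝟙-nonNeg (b ∧ true)) (w≤w′ F EF≡false)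
    term {F} b true  _        = subst (λ x → 𝟙 x * w F ≤ 𝟙 x * w′ F) (sym (BoolP.∧-zeroʳ b))
      (ℚP.≤-reflexive (trans (ℚP.*-zeroˡ (w F)) (sym (ℚP.*-zeroˡ (w′ F)))))

  ∑evalOutside-* : ∀ E T ω c (w : Fin n → ℚ) →
                   ∑evalOutside E T ω (λ F → c * w F) ≡ c * ∑evalOutside E T ω w
  ∑evalOutside-* E T ω c w = trans
    (sumFin-cong n (λ F → swap (𝟙 (evaluates T ω F ∧ not (lookup E F))) c (w F))) (sumFin-* n c _)
    where
    swap : ∀ a c x → a * (c * x) ≡ c * (a * x)
    swap = solve 3 (λ a c x → a :* (c :* x) := c :* (a :* x)) refl

  ∑evalOutside-nonNeg : ∀ E T ω {w : Fin n → ℚ} → (∀ F → 0ℚ ≤ w F) → 0ℚ ≤ ∑evalOutside E T ω w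
  ∑evalOutside-nonNeg E T ω 0≤w =
    sumFin-nonNeg n (λ F → *-nonNeg (𝟙-nonNeg (evaluates T ω F ∧ not (lookup E F))) (0≤w F))

  -- Obliviousness makes "is F evaluated" independent of the state of F.
  𝔼′-∑evalOutside : ∀ {p : Law n m} → IsLaw p → ∀ E T (w : Fin n → Subset m → ℚ) →
    𝔼′ p (λ ω → ∑evalOutside E T ω (λ F → w F (lookup ω F)))
      ≡ 𝔼′ p (λ ω → ∑evalOutside E T ω (λ F → ∑ˢ (λ S → p F S * w F S)))
  𝔼′-∑evalOutside {p} law E T w = begin
    𝔼′ p (λ ω → ∑evalOutside E T ω (λ F → w F (lookup ω F)))
      ≡⟨ 𝔼′-sumFin p n (λ F ω → 𝟙 (chosen F ω) * w F (lookup ω F)) ⟩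
    sumFin n (λ F → 𝔼′ p (λ ω → 𝟙 (chosen F ω) * w F (lookup ω F)))
      ≡⟨ sumFin-cong n (λ F → trans (𝔼′-product law F (ignores F) (w F)) (sym (mean F))) ⟩
    sumFin n (λ F → 𝔼′ p (λ ω → 𝟙 (chosen F ω) * ∑ˢ (λ S → p F S * w F S)))
      ≡⟨ sym (𝔼′-sumFin p n (λ F ω → 𝟙 (chosen F ω) * ∑ˢ (λ S → p F S * w F S))) ⟩
    𝔼′ p (λ ω → ∑evalOutside E T ω (λ F → ∑ˢ (λ S → p F S * w F S))) ∎
    where
    open ≡-Reasoning
    chosen : Fin n → Realization n m → Bool
    chosen F ω = evaluates T ω F ∧ not (lookup E F)
    ignores : ∀ F → Ignores (𝟙 ∘ chosen F) F
    ignores F ω S = cong (λ b → 𝟙 (b ∧ not (lookup E F))) (evaluates-oblivious T ω F S)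
    mean : ∀ F → 𝔼′ p (λ ω → 𝟙 (chosen F ω) * ∑ˢ (λ S → p F S * w F S))
                 ≡ 𝔼′ p (𝟙 ∘ chosen F) * ∑ˢ (λ S → p F S * w F S)
    mean F = trans (𝔼′-cong p (λ ω → ℚP.*-comm (𝟙 (chosen F ω)) μ))
                   (trans (𝔼′-* p μ (𝟙 ∘ chosen F)) (ℚP.*-comm μ (𝔼′ p (𝟙 ∘ chosen F))))
      where μ = ∑ˢ (λ S → p F S * w F S)

  costOn-evaluates : ∀ (C : Fin n → ℚ) (T : Tree n m) ω →
                     costOn C T ω ≡ sumFin n (λ F → 𝟙 (evaluates T ω F) * C F)
  costOn-evaluates C T ω = sumFin-cong n (λ F → cong (λ b → 𝟙 b * C F) (lookup-evaluated T ω F))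

  costOn-eval : ∀ (C : Fin n → ℚ) → (∀ F → 0ℚ ≤ C F) → ∀ F k ω →
                costOn C (eval F k) ω ≤ C F + costOn C (k (lookup ω F)) ω
  costOn-eval C 0≤C F k ω = begin
    costOn C (eval F k) ω
      ≡⟨ costOn-evaluates C (eval F k) ω ⟩
    sumFin n (λ F′ → 𝟙 (does (F ≟ F′) ∨ evaluates T′ ω F′) * C F′)
      ≤⟨ sumFin-mono n (λ F′ → union-bound (does (F ≟ F′)) (evaluates T′ ω F′) (0≤C F′)) ⟩
    sumFin n (λ F′ → 𝟙 (does (F ≟ F′)) * C F′ + 𝟙 (evaluates T′ ω F′) * C F′)
      ≡⟨ sumFin-+ n _ _ ⟩
    sumFin n (λ F′ → 𝟙 (does (F ≟ F′)) * C F′) + sumFin n (λ F′ → 𝟙 (evaluates T′ ω F′) * C F′)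
      ≡⟨ cong₂ _+_ (trans (sumFin-single n F only-F) (this-F))
                   (sym (costOn-evaluates C T′ ω)) ⟩
    C F + costOn C T′ ω ∎
    where
    open ℚP.≤-Reasoning
    T′ = k (lookup ω F)
    union-bound : ∀ a b {c} → 0ℚ ≤ c → 𝟙 (a ∨ b) * c ≤ 𝟙 a * c + 𝟙 b * c
    union-bound true  true  {c} 0≤c = ≤-by-slack (1ℚ * c) (subst (0ℚ ≤_) (sym (ℚP.*-identityˡ c)) 0≤c) refl
    union-bound true  false {c} 0≤c =
      ℚP.≤-reflexive (sym (trans (cong (_+_ (1ℚ * c)) (ℚP.*-zeroˡ c)) (ℚP.+-identityʳ _)))
    union-bound false b     {c} 0≤c =
      ℚP.≤-reflexive (sym (trans (cong (_+ 𝟙 b * c) (ℚP.*-zeroˡ c)) (ℚP.+-identityˡ _)))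
    only-F : ∀ F′ → F′ ≢ F → 𝟙 (does (F ≟ F′)) * C F′ ≡ 0ℚ
    only-F F′ F′≢F = trans (cong (λ b → 𝟙 b * C F′) (dec-false (F ≟ F′) (F′≢F ∘ sym))) (ℚP.*-zeroˡ (C F′))
    this-F : 𝟙 (does (F ≟ F)) * C F ≡ C F
    this-F = trans (cong (λ b → 𝟙 b * C F) (dec-true (F ≟ F) refl)) (ℚP.*-identityˡ (C F))

  costOn-stop : ∀ (C : Fin n → ℚ) ω → costOn C (stop {n} {m}) ω ≡ 0ℚ
  costOn-stop C ω = trans (costOn-evaluates C stop ω)
    (trans (sumFin-cong n (λ F → ℚP.*-zeroˡ (C F))) (sumFin-zero n))

  costOn≡∑evalOutside∅ : ∀ (C : Fin n → ℚ) (T : Tree n m) ω → costOn C T ω ≡ ∑evalOutside ∅ T ω C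
  costOn≡∑evalOutside∅ C T ω = trans (costOn-evaluates C T ω)
    (∑evalOutside-all ∅ T ω C (λ F ∅F≡true → contradiction (trans (sym (lookup-∅ F)) ∅F≡true) λ ()))

  feasible-covers : ∀ {p : Law n m} → IsLaw p → PerfectCoverage p → ∀ O → Feasible p O →
                    ∀ ω → InSupport p ω → ∀ e → covers O ω e ≡ true
  feasible-covers {p} law perfect O feasible ω ω∈supp e = begin
    covers O ω e            ≡⟨ sym (lookup-covered O ω e) ⟩
    lookup (covered O ω) e  ≡⟨ cong (λ W → lookup W e) (trans covered≡union union≡full) ⟩
    lookup full e           ≡⟨ lookup-full e ⟩
    true                    ∎
    where
    open ≡-Reasoning
    covered≡union : covered O ω ≡ unionAll ω
    covered≡union = toWitness (almost-sure law (λ ω → covered O ω ==ˢ unionAll ω) feasible ω ω∈supp)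
    union≡full : unionAll ω ≡ full
    union≡full = toWitness (almost-sure law (λ ω → unionAll ω ==ˢ full) perfect ω ω∈supp)

  covering-bound : ∀ (U : Subset m) T ω → (∀ e → lookup U e ≡ true → covers T ω e ≡ true) →
                   size U ≤ sumFin n (λ F → 𝟙 (evaluates T ω F) * size (U ∩ lookup ω F))
  covering-bound U T ω covered = begin
    size U
      ≡⟨ size≡∑𝟙 U ⟩
    sumFin m (λ e → 𝟙 (lookup U e))
      ≤⟨ sumFin-mono m per-element ⟩
    sumFin m (λ e → sumFin n (λ F → 𝟙 (evaluates T ω F) * 𝟙 (lookup (U ∩ lookup ω F) e)))
      ≡⟨ sym (sumFin-comm n m _) ⟩
    sumFin n (λ F → sumFin m (λ e → 𝟙 (evaluates T ω F) * 𝟙 (lookup (U ∩ lookup ω F) e)))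
      ≡⟨ sumFin-cong n (λ F → trans (sumFin-* m (𝟙 (evaluates T ω F)) _)
                                    (cong (𝟙 (evaluates T ω F) *_) (sym (size≡∑𝟙 (U ∩ lookup ω F))))) ⟩
    sumFin n (λ F → 𝟙 (evaluates T ω F) * size (U ∩ lookup ω F)) ∎
    where
    open ℚP.≤-Reasoning
    term : Fin m → Fin n → ℚ
    term e F = 𝟙 (evaluates T ω F) * 𝟙 (lookup (U ∩ lookup ω F) e)
    0≤term : ∀ e F → 0ℚ ≤ term e F
    0≤term e F = *-nonNeg (𝟙-nonNeg (evaluates T ω F)) (𝟙-nonNeg (lookup (U ∩ lookup ω F) e))
    per-element : ∀ e → 𝟙 (lookup U e) ≤ sumFin n (term e)
    per-element e with lookup U e in Ue
    ... | false = sumFin-nonNeg n (0≤term e)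
    ... | true with covers⇒evaluates T ω e (covered e Ue)
    ...   | F , evaluatesF , e∈ωF = ℚP.≤-trans (ℚP.≤-reflexive (sym term≡1)) (sumFin-≥-term n F (0≤term e))
      where
      term≡1 : term e F ≡ 1ℚ
      term≡1 rewrite evaluatesF | lookup-∩ U (lookup ω F) e | Ue | e∈ωF = refl

  𝔼′-eval : ∀ {p : Law n m} → IsLaw p → (C : Fin n → ℚ) → (∀ F → 0ℚ ≤ C F) → ∀ F k →
            𝔼′ p (costOn C (eval F k)) ≤ C F + ∑ˢ (λ S → p F S * 𝔼′ (condition p F S) (costOn C (k S)))
  𝔼′-eval {p} law C 0≤C F k = begin
    𝔼′ p (costOn C (eval F k))
      ≤⟨ 𝔼′-mono (IsLaw.nonNeg law) (λ ω _ → costOn-eval C 0≤C F k ω) ⟩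
    𝔼′ p (λ ω → C F + costOn C (k (lookup ω F)) ω)
      ≡⟨ 𝔼′-+ p (λ _ → C F) _ ⟩
    𝔼′ p (λ _ → C F) + 𝔼′ p (λ ω → costOn C (k (lookup ω F)) ω)
      ≡⟨ cong₂ _+_ (𝔼′-const law (C F)) (𝔼′-total p F _) ⟩
    C F + ∑ˢ (λ S → p F S * 𝔼′ (condition p F S) (λ ω → costOn C (k (lookup ω F)) ω))
      ≡⟨ cong (_+_ (C F)) (∑ˡ-cong (allSubsets m) (λ S → cong (p F S *_)
           (𝔼′-cong-support (IsLaw.nonNeg (condition-isLaw p F S law))
             (λ ω ω∈supp → cong (λ S′ → costOn C (k S′) ω) (condition-support-at p F S ω ω∈supp))))) ⟩
    C F + ∑ˢ (λ S → p F S * 𝔼′ (condition p F S) (costOn C (k S))) ∎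
    where open ℚP.≤-Reasoning

  𝔼′-∑evalOutside-split : ∀ {p : Law n m} → IsLaw p → ∀ E F T (w : Fin n → ℚ) → lookup E F ≡ false →
    𝔼′ p (λ ω → ∑evalOutside E T ω w)
      ≡ ∑ˢ (λ S → p F S * 𝔼′ (condition p F S) (λ ω → ∑evalOutside (E ∪ ⁅ F ⁆) T ω w))
        + 𝔼′ p (λ ω → 𝟙 (evaluates T ω F)) * w F
  𝔼′-∑evalOutside-split {p} law E F T w EF≡false = begin
    𝔼′ p (λ ω → ∑evalOutside E T ω w)
      ≡⟨ 𝔼′-cong p (λ ω → ∑evalOutside-split E F T ω w EF≡false) ⟩
    𝔼′ p (λ ω → ∑evalOutside (E ∪ ⁅ F ⁆) T ω w + 𝟙 (evaluates T ω F) * w F)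
      ≡⟨ 𝔼′-+ p _ _ ⟩
    𝔼′ p (λ ω → ∑evalOutside (E ∪ ⁅ F ⁆) T ω w) + 𝔼′ p (λ ω → 𝟙 (evaluates T ω F) * w F)
      ≡⟨ cong₂ _+_ (𝔼′-total p F _)
                   (trans (𝔼′-cong p (λ ω → ℚP.*-comm _ (w F)))
                          (trans (𝔼′-* p (w F) _) (ℚP.*-comm (w F) _))) ⟩
    ∑ˢ (λ S → p F S * 𝔼′ (condition p F S) (λ ω → ∑evalOutside (E ∪ ⁅ F ⁆) T ω w))
      + 𝔼′ p (λ ω → 𝟙 (evaluates T ω F)) * w F ∎
    where open ≡-Reasoning

mass-∑ˢ : ∀ {n m} (p : Law n m) F (U : Subset m) → mass p F U ≡ ∑ˢ (λ T → p F T * size (U ∩ T))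
mass-∑ˢ {m = m} p F U = begin
  sumFin m (λ e → 𝟙 (lookup U e) * ∑ˢ (λ T → p F T * 𝟙 (lookup T e)))
    ≡⟨ sumFin-cong m (λ e → sym (∑ˡ-* (allSubsets m) (𝟙 (lookup U e)) _)) ⟩
  sumFin m (λ e → ∑ˢ (λ T → 𝟙 (lookup U e) * (p F T * 𝟙 (lookup T e))))
    ≡⟨ sumFin-∑ˡ m (allSubsets m) _ ⟩
  ∑ˢ (λ T → sumFin m (λ e → 𝟙 (lookup U e) * (p F T * 𝟙 (lookup T e))))
    ≡⟨ ∑ˡ-cong (allSubsets m) (λ T → trans (sumFin-cong m (λ e → regroup T e)) (sumFin-* m (p F T) _)) ⟩
  ∑ˢ (λ T → p F T * sumFin m (λ e → 𝟙 (lookup (U ∩ T) e)))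
    ≡⟨ ∑ˡ-cong (allSubsets m) (λ T → cong (p F T *_) (sym (size≡∑𝟙 (U ∩ T)))) ⟩
  ∑ˢ (λ T → p F T * size (U ∩ T)) ∎
  where
  open ≡-Reasoning
  swap : ∀ a b c → a * (b * c) ≡ b * (a * c)
  swap = solve 3 (λ a b c → a :* (b :* c) := b :* (a :* c)) refl
  𝟙-∧ : ∀ a b → 𝟙 a * 𝟙 b ≡ 𝟙 (a ∧ b)
  𝟙-∧ true  b = ℚP.*-identityˡ (𝟙 b)
  𝟙-∧ false b = ℚP.*-zeroˡ (𝟙 b)
  regroup : ∀ T e → 𝟙 (lookup U e) * (p F T * 𝟙 (lookup T e)) ≡ p F T * 𝟙 (lookup (U ∩ T) e)
  regroup T e = trans (swap (𝟙 (lookup U e)) (p F T) _)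
    (cong (p F T *_) (trans (𝟙-∧ (lookup U e) (lookup T e)) (cong 𝟙 (sym (lookup-∩ U T e)))))

mass-nonNeg : ∀ {n m} {p : Law n m} → NonNegLaw p → ∀ F U → 0ℚ ≤ mass p F U
mass-nonNeg {p = p} 0≤p F U = subst (0ℚ ≤_) (sym (mass-∑ˢ p F U))
  (∑ˡ-nonNeg (allSubsets _) (λ T → *-nonNeg (0≤p F T) (size-nonNeg (U ∩ T))))

-- Analysis of Greedy

ratio-* : ∀ c s pos → ratio c s pos * s ≡ c
ratio-* c s pos = trans (ℚP.*-assoc c ((1/ s) {{>-nonZero pos}}) s)
  (trans (cong (c *_) (ℚP.*-inverseˡ s {{>-nonZero pos}})) (ℚP.*-identityʳ c))

ratio-nonNeg : ∀ c s pos → 0ℚ ≤ c → 0ℚ ≤ ratio c s pos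
ratio-nonNeg c s pos 0≤c =
  *-nonNeg 0≤c (ℚP.<⇒≤ (ℚP.positive⁻¹ _ {{ℚP.1/pos⇒pos s {{positive pos}}}}))

module Greedy {n m : ℕ} (C : Fin n → ℚ) (p₀ : Law n m) (inst : IsInstance C p₀) where

  open IsInstance inst

  p₀-isLaw : IsLaw p₀
  p₀-isLaw = record { nonNeg = prob-nonneg ; total = prob-sum1 }

  greedy-ratio-bound : ∀ {E U F} (pos : 0ℚ < mass p₀ F U) →
    (∀ F′ → F′ ∉ E → (pos′ : 0ℚ < mass p₀ F′ U) →
       ratio (C F) (mass p₀ F U) pos ≤ ratio (C F′) (mass p₀ F′ U) pos′) →
    ∀ F′ → lookup E F′ ≡ false → ratio (C F) (mass p₀ F U) pos * mass p₀ F′ U ≤ C F′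
  greedy-ratio-bound {E} {U} {F} pos minimal F′ EF′≡false =
    by-cases (positive-or-zero (mass-nonNeg {p = p₀} prob-nonneg F′ U))
    where
    ρ = ratio (C F) (mass p₀ F U) pos
    by-cases : 0ℚ < mass p₀ F′ U ⊎ mass p₀ F′ U ≡ 0ℚ → ρ * mass p₀ F′ U ≤ C F′
    by-cases (inj₁ pos′) = begin
      ρ * mass p₀ F′ U
        ≤⟨ ℚP.*-monoʳ-≤-nonNeg (mass p₀ F′ U) {{nonNegative (ℚP.<⇒≤ pos′)}}
             (minimal F′ (lookup≡false⇒∉ EF′≡false) pos′) ⟩
      ratio (C F′) (mass p₀ F′ U) pos′ * mass p₀ F′ U
        ≡⟨ ratio-* (C F′) (mass p₀ F′ U) pos′ ⟩
      C F′ ∎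
      where open ℚP.≤-Reasoning
    by-cases (inj₂ mass≡0) = subst (_≤ C F′)
      (sym (trans (cong (ρ *_) mass≡0) (ℚP.*-zeroʳ ρ))) (cost-nonneg F′)

  -- p models the states once the items of E have been evaluated and U is still uncovered.
  record ResidualLaw (E : Subset n) (U : Subset m) (O : Tree n m) (p : Law n m) : Set where
    field
      isLaw       : IsLaw p
      unevaluated : ∀ F → lookup E F ≡ false → ∀ S → p F S ≡ p₀ F S
      disjoint    : ∀ F → lookup E F ≡ true → ∀ S → 0ℚ < p F S → Disjoint U S
      covering    : ∀ ω → InSupport p ω → ∀ e → lookup U e ≡ true → covers O ω e ≡ true

  module _ {E : Subset n} {U : Subset m} {O : Tree n m} {p : Law n m} (res : ResidualLaw E U O p)
           {F : Fin n} (EF≡false : lookup E F ≡ false) where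

    open ResidualLaw res

    residual-condition : ∀ {S} → 0ℚ < p F S → ResidualLaw (E ∪ ⁅ F ⁆) (U ─ S) O (condition p F S)
    residual-condition {S} 0<pS = record
      { isLaw       = condition-isLaw p F S isLaw
      ; unevaluated = unevaluated′
      ; disjoint    = disjoint′
      ; covering    = λ ω ω∈supp e e∈U─S → covering ω (condition-support p F S 0<pS ω ω∈supp) e
                        (∧-trueˡ (lookup U e) (trans (sym (lookup-─ U S e)) e∈U─S))
      }
      where
      ∧-trueˡ : ∀ a {b} → a ∧ b ≡ true → a ≡ true
      ∧-trueˡ true _ = refl
      unevaluated′ : ∀ F′ → lookup (E ∪ ⁅ F ⁆) F′ ≡ false → ∀ T → condition p F S F′ T ≡ p₀ F′ T
      unevaluated′ F′ E′F′≡false T with F′ ≟ F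
      ... | yes refl = contradiction (trans (sym (lookup-∪⁅⁆-self E F)) E′F′≡false) λ ()
      ... | no F′≢F  = trans (cong (λ r → r T) (VecFP.updateAt-minimal F′ F p F′≢F))
                             (unevaluated F′ (trans (sym (lookup-∪⁅⁆-other E F′≢F)) E′F′≡false) T)
      disjoint′ : ∀ F′ → lookup (E ∪ ⁅ F ⁆) F′ ≡ true → ∀ T → 0ℚ < condition p F S F′ T → Disjoint (U ─ S) T
      disjoint′ F′ E′F′≡true T 0<qT with F′ ≟ F
      ... | yes refl = subst (Disjoint (U ─ S)) (sym (δ-support S T
                         (subst (λ r → 0ℚ < r T) (VecFP.updateAt-updates F p) 0<qT))) (Disjoint-─ U S)
      ... | no F′≢F  = Disjoint-─ˡ U S {T} (disjoint F′ (trans (sym (lookup-∪⁅⁆-other E F′≢F)) E′F′≡true) T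
                         (subst (λ r → 0ℚ < r T) (VecFP.updateAt-minimal F′ F p F′≢F) 0<qT))

    residual-coverage : ∀ {S} → 0ℚ < p F S → ∀ ω → InSupport (condition p F S) ω →
      size U ≤ ∑evalOutside (E ∪ ⁅ F ⁆) O ω (λ F′ → size (U ∩ lookup ω F′))
               + 𝟙 (evaluates O ω F) * size (U ∩ S)
    residual-coverage {S} 0<pS ω ω∈supp = begin
      size U
        ≤⟨ covering-bound U O ω (covering ω ω∈supp₀) ⟩
      sumFin n (λ F′ → 𝟙 (evaluates O ω F′) * w F′)
        ≡⟨ ∑evalOutside-all E O ω w (λ F′ EF′≡true →
             Disjoint⇒size≡0 {U = U} {lookup ω F′} (disjoint F′ EF′≡true (lookup ω F′) (ω∈supp₀ F′))) ⟩
      ∑evalOutside E O ω w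
        ≡⟨ ∑evalOutside-split E F O ω w EF≡false ⟩
      ∑evalOutside (E ∪ ⁅ F ⁆) O ω w + 𝟙 (evaluates O ω F) * w F
        ≡⟨ cong (λ T → ∑evalOutside (E ∪ ⁅ F ⁆) O ω w + 𝟙 (evaluates O ω F) * size (U ∩ T))
                (condition-support-at p F S ω ω∈supp) ⟩
      ∑evalOutside (E ∪ ⁅ F ⁆) O ω w + 𝟙 (evaluates O ω F) * size (U ∩ S) ∎
      where
      open ℚP.≤-Reasoning
      ω∈supp₀ = condition-support p F S 0<pS ω ω∈supp
      w : Fin n → ℚ
      w F′ = size (U ∩ lookup ω F′)

    greedy-pays : ∀ {S} → 0ℚ < p F S → ∀ {ρ} → 0ℚ ≤ ρ →
      (∀ F′ → lookup E F′ ≡ false → ρ * mass p₀ F′ U ≤ C F′) →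
      ρ * (size U - 𝔼′ p (λ ω → 𝟙 (evaluates O ω F)) * size (U ∩ S))
        ≤ 𝔼′ (condition p F S) (λ ω → ∑evalOutside (E ∪ ⁅ F ⁆) O ω C)
    greedy-pays {S} 0<pS {ρ} 0≤ρ ρ-bound = begin
      ρ * (size U - 𝔼′ p evaluatesF * size (U ∩ S))
        ≡⟨ cong (ρ *_) (sym (trans (𝔼′-affine pₛ-law (size U) evaluatesF (size (U ∩ S)))
             (cong (λ π → size U - π * size (U ∩ S)) (𝔼′-condition-ignored isLaw F S ignoresF)))) ⟩
      ρ * 𝔼′ pₛ (λ ω → size U - evaluatesF ω * size (U ∩ S))
        ≤⟨ scale-≤ 0≤ρ (𝔼′-mono pₛ-nonNeg (λ ω ω∈supp → x≤y+z⇒x-z≤y (residual-coverage 0<pS ω ω∈supp))) ⟩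
      ρ * 𝔼′ pₛ (λ ω → ∑evalOutside E′ O ω (λ F′ → size (U ∩ lookup ω F′)))
        ≡⟨ cong (ρ *_) (𝔼′-∑evalOutside pₛ-law E′ O (λ _ T → size (U ∩ T))) ⟩
      ρ * 𝔼′ pₛ (λ ω → ∑evalOutside E′ O ω μ)
        ≡⟨ sym (trans (𝔼′-cong pₛ (λ ω → ∑evalOutside-* E′ O ω ρ μ)) (𝔼′-* pₛ ρ _)) ⟩
      𝔼′ pₛ (λ ω → ∑evalOutside E′ O ω (λ F′ → ρ * μ F′))
        ≤⟨ 𝔼′-mono pₛ-nonNeg (λ ω _ → ∑evalOutside-mono E′ O ω pays) ⟩
      𝔼′ pₛ (λ ω → ∑evalOutside E′ O ω C) ∎
      where
      open ℚP.≤-Reasoning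
      pₛ = condition p F S
      E′ = E ∪ ⁅ F ⁆
      pₛ-law = condition-isLaw p F S isLaw
      pₛ-nonNeg = IsLaw.nonNeg pₛ-law
      evaluatesF : Realization n m → ℚ
      evaluatesF ω = 𝟙 (evaluates O ω F)
      ignoresF : Ignores evaluatesF F
      ignoresF ω T = cong 𝟙 (evaluates-oblivious O ω F T)
      μ : Fin n → ℚ
      μ F′ = ∑ˢ (λ T → pₛ F′ T * size (U ∩ T))
      pays : ∀ F′ → lookup E′ F′ ≡ false → ρ * μ F′ ≤ C F′
      pays F′ E′F′≡false = subst (λ x → ρ * x ≤ C F′)
        (sym (trans (∑ˡ-cong (allSubsets m) (λ T → cong (_* size (U ∩ T))
                      (ResidualLaw.unevaluated (residual-condition 0<pS) F′ E′F′≡false T)))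
                    (sym (mass-∑ˢ p₀ F′ U))))
        (ρ-bound F′ (lookup-∪-falseˡ E ⁅ F ⁆ F′ E′F′≡false))

    module _ (pos : 0ℚ < mass p₀ F U)
             (minimal : ∀ F′ → F′ ∉ E → (pos′ : 0ℚ < mass p₀ F′ U) →
                          ratio (C F) (mass p₀ F U) pos ≤ ratio (C F′) (mass p₀ F′ U) pos′) where

      private
        ρ π H : ℚ
        ρ = ratio (C F) (mass p₀ F U) pos
        π = 𝔼′ p (λ ω → 𝟙 (evaluates O ω F))
        H = harmonic ∣ U ∣
        costAfter : Subset m → ℚ
        costAfter S = 𝔼′ (condition p F S) (λ ω → ∑evalOutside (E ∪ ⁅ F ⁆) O ω C)

      greedy-price : ∑ˢ (λ S → p F S * (ρ * size (U ∩ S))) ≡ C F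
      greedy-price = begin
        ∑ˢ (λ S → p F S * (ρ * size (U ∩ S)))
          ≡⟨ ∑ˡ-cong (allSubsets m) (λ S → swap (p F S) ρ (size (U ∩ S))) ⟩
        ∑ˢ (λ S → ρ * (p F S * size (U ∩ S)))
          ≡⟨ ∑ˡ-* (allSubsets m) ρ _ ⟩
        ρ * ∑ˢ (λ S → p F S * size (U ∩ S))
          ≡⟨ cong (ρ *_) (trans (∑ˡ-cong (allSubsets m) (λ S → cong (_* size (U ∩ S)) (unevaluated F EF≡false S)))
                                (sym (mass-∑ˢ p₀ F U))) ⟩
        ρ * mass p₀ F U
          ≡⟨ ratio-* (C F) (mass p₀ F U) pos ⟩
        C F ∎
        where
        open ≡-Reasoning
        swap : ∀ a b c → a * (b * c) ≡ b * (a * c)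
        swap = solve 3 (λ a b c → a :* (b :* c) := b :* (a :* c)) refl

      greedy-harmonic-step : ∀ {S} → 0ℚ < p F S →
        harmonic ∣ U ─ S ∣ * costAfter S ≤ H * costAfter S + (H * π - 1ℚ) * (ρ * size (U ∩ S))
      greedy-harmonic-step {S} 0<pS =
        subst (λ u → harmonic ∣ U ─ S ∣ * costAfter S
                       ≤ harmonic u * costAfter S + (harmonic u * π - 1ℚ) * (ρ * size (U ∩ S)))
              (sym (∣∣-split U S))
              (harmonic-step ∣ U ∩ S ∣ ∣ U ─ S ∣ 0≤ρ 0≤π
                (subst (λ u → ρ * (fromℕ u - π * size (U ∩ S)) ≤ costAfter S) (∣∣-split U S)
                  (greedy-pays 0<pS 0≤ρ (greedy-ratio-bound {E} {U} {F} pos minimal))))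
        where
        0≤ρ : 0ℚ ≤ ρ
        0≤ρ = ratio-nonNeg (C F) (mass p₀ F U) pos (cost-nonneg F)
        0≤π : 0ℚ ≤ π
        0≤π = 𝔼′-nonNeg (IsLaw.nonNeg isLaw) (λ ω _ → 𝟙-nonNeg (evaluates O ω F))

      greedy-step : ∀ {k} →
        (∀ S → 0ℚ < p F S → 𝔼′ (condition p F S) (costOn C (k S)) ≤ harmonic ∣ U ─ S ∣ * costAfter S) →
        𝔼′ p (costOn C (eval F k)) ≤ H * 𝔼′ p (λ ω → ∑evalOutside E O ω C)
      greedy-step {k} induction = begin
        𝔼′ p (costOn C (eval F k))
          ≤⟨ 𝔼′-eval isLaw C cost-nonneg F k ⟩
        C F + ∑ˢ (λ S → p F S * 𝔼′ (condition p F S) (costOn C (k S)))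
          ≤⟨ ℚP.+-monoʳ-≤ (C F) (∑ˡ-mono (allSubsets m) (λ S → scale-≤-if-pos (IsLaw.nonNeg isLaw F S)
               (λ 0<pS → ℚP.≤-trans (induction S 0<pS) (greedy-harmonic-step 0<pS)))) ⟩
        C F + ∑ˢ (λ S → p F S * (H * costAfter S + (H * π - 1ℚ) * (ρ * size (U ∩ S))))
          ≡⟨ cong (_+_ (C F))
               (∑ˡ-weighted (allSubsets m) (p F) costAfter (λ S → ρ * size (U ∩ S)) H (H * π - 1ℚ)) ⟩
        C F + (H * X + (H * π - 1ℚ) * ∑ˢ (λ S → p F S * (ρ * size (U ∩ S))))
          ≡⟨ cong (λ y → C F + (H * X + (H * π - 1ℚ) * y)) greedy-price ⟩
        C F + (H * X + (H * π - 1ℚ) * C F)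
          ≡⟨ collect (C F) H X π ⟩
        H * (X + π * C F)
          ≡⟨ cong (H *_) (sym (𝔼′-∑evalOutside-split isLaw E F O C EF≡false)) ⟩
        H * 𝔼′ p (λ ω → ∑evalOutside E O ω C) ∎
        where
        open ℚP.≤-Reasoning
        X = ∑ˢ (λ S → p F S * costAfter S)
        collect : ∀ c H X π → c + (H * X + (H * π - 1ℚ) * c) ≡ H * (X + π * c)
        collect = solve 4 (λ c H X π → c :+ (H :* X :+ (H :* π :- con 1ℚ) :* c) := H :* (X :+ π :* c)) refl

  residual-initial : PerfectCoverage p₀ → ∀ O → Feasible p₀ O → ResidualLaw ∅ full O p₀
  residual-initial perfect O feasible = record
    { isLaw       = p₀-isLaw
    ; unevaluated = λ _ _ _ → refl
    ; disjoint    = λ F ∅F≡true → contradiction (trans (sym (lookup-∅ F)) ∅F≡true) λ ()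
    ; covering    = λ ω ω∈supp e _ → feasible-covers p₀-isLaw perfect O feasible ω ω∈supp e
    }

  greedy-bound : ∀ {E U G} → IsGreedyFrom C p₀ E U G → ∀ O p → ResidualLaw E U O p →
                 𝔼′ p (costOn C G) ≤ harmonic ∣ U ∣ * 𝔼′ p (λ ω → ∑evalOutside E O ω C)
  greedy-bound {E} {U} (gstop _) O p res = begin
    𝔼′ p (costOn C Tree.stop)
      ≡⟨ trans (𝔼′-cong p (costOn-stop C)) (𝔼′-zero p) ⟩
    0ℚ
      ≤⟨ *-nonNeg (harmonic-nonNeg ∣ U ∣) (𝔼′-nonNeg (IsLaw.nonNeg (ResidualLaw.isLaw res))
           (λ ω _ → ∑evalOutside-nonNeg E O ω cost-nonneg)) ⟩
    harmonic ∣ U ∣ * 𝔼′ p (λ ω → ∑evalOutside E O ω C) ∎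
    where open ℚP.≤-Reasoning hiding (stop)
  greedy-bound (geval {F = F} {k} _ F∉E pos minimal greedy-k) O p res =
    greedy-step res EF≡false pos minimal {k} (λ S 0<pS →
      greedy-bound (greedy-k S (subst (0ℚ <_) (ResidualLaw.unevaluated res F EF≡false S) 0<pS))
                   O (condition p F S) (residual-condition res EF≡false 0<pS))
    where
    EF≡false = ∉⇒lookup≡false F∉E

theorem1 : {n m : ℕ} (C : Fin n → ℚ) (p : Fin n → Subset m → ℚ) →
           IsInstance C p →
           PerfectCoverage p →
           (G : Tree n m) → IsGreedy C p G →
           (O : Tree n m) → Feasible p O →
           expCost C p G ≤ harmonic m * expCost C p O
theorem1 {n} {m} C p inst perfect G greedy O feasible = begin
  expCost C p G
    ≡⟨ 𝔼≡𝔼′ p (costOn C G) ⟩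
  𝔼′ p (costOn C G)
    ≤⟨ greedy-bound greedy O p (residual-initial perfect O feasible) ⟩
  harmonic ∣ full {m} ∣ * 𝔼′ p (λ ω → ∑evalOutside ∅ O ω C)
    ≡⟨ cong₂ _*_ (cong harmonic (SubsetP.∣⊤∣≡n m)) (𝔼′-cong p (λ ω → sym (costOn≡∑evalOutside∅ C O ω))) ⟩
  harmonic m * 𝔼′ p (costOn C O)
    ≡⟨ cong (harmonic m *_) (sym (𝔼≡𝔼′ p (costOn C O))) ⟩
  harmonic m * expCost C p O ∎
  where
  open ℚP.≤-Reasoning
  open Greedy C p inst
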